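{- The fractional allocation $\mathbf{X}$ returned by the Level-Based Proportional Allocation algorithm for makespan (described in the context) satisfies $\mathrm{obj}(\mathbf{X})\le O(\log m)\cdot\mathrm{OPT}$.
   Context: Level-Based Proportional Allocation for makespan. Input: reported speeds, sorted so that $s_1\ge s_2\ge\dots\ge s_m$, and online reported job sizes $p_1,p_2,\dots$. For each $i$, let $\bar s_i$ be the largest power of $2$ (integer exponent) that is $\le s_i$. Let $K=\lfloor\log_2 m\rfloor+1$, $r_k=\bar s_1/2^{k-1}$ for $k\in[K]$, $\mathcal{M}_k=\{i:\bar s_i=r_k\}$, and $\mathcal{M}_{\le k}=\bigcup_{k'\le k}\mathcal{M}_{k'}$; machines with $\bar s_i<\bar s_1/m$ receive nothing. Job 1: $x_{i1}=1/|\mathcal{M}_1|$ for $i\in\mathcal{M}_1$; set $\Lambda\gets p_1/r_1$ and all counters $C_{i,k}\gets0$. Each later job $j$: let $k(j)=\max(\{k\in[K]:p_j\le r_k\Lambda\}\cup\{1\})$; for each $i\in\mathcal{M}_{\le k(j)}$ set $x_{ij}=\bar s_i/\sum_{t\in\mathcal{M}_{\le k(j)}}\bar s_t$ and $C_{i,k(j)}\gets C_{i,k(j)}+x_{ij}p_j/\bar s_i$ (other $x_{ij}=0$). Then, only if $k(j)\le K-1$: if $p_j/r_1>\Lambda$, double $\Lambda$ repeatedly until $\Lambda\ge p_j/r_1$; else if $C_{1,k(j)}>\Lambda$, double $\Lambda$ once; whenever $\Lambda$ was doubled, reset all $C_{i,k}\gets0$. $\mathrm{obj}(\mathbf{X})=\max_i\sum_j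 x_{ij}p_j/s_i$ is the fractional makespan and $\mathrm{OPT}$ the optimal integral makespan.
   Formalization: The reported speeds $s_i$ and the job sizes $p_j$ take values in the rationals. -}

module Defs where

open import Data.Nat as ℕ using (ℕ; zero; suc; _⊔_)
open import Data.Nat.Logarithm using (⌊log₂_⌋)
open import Data.Integer as ℤ using (ℤ; +_; -[1+_])
open import Data.Rational using (ℚ; 0ℚ; 1ℚ; _+_; _*_; _÷_; _≤_; _<_; ≢-nonZero; ceiling)
open import Data.Rational.Properties using (_≟_; _≤?_; _<?_)
import Data.Rational as Q
open import Data.Fin using (Fin; zero; suc)
open import Data.Fin.Properties as FinP using ()
open import Data.List using (List; []; _∷_; map; upTo; foldr; length; lookup; zipWith)
open import Data.Bool using (Bool; true; false; if_then_else_; _∨_)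
open import Relation.Nullary using (does; yes; no)

-- Division returning 0 on a zero denominator.  It is only ever used
-- with strictly positive denominators (sums of powers of two, speeds),
-- so the default value is never relevant.
_÷₀_ : ℚ → ℚ → ℚ
p ÷₀ q with q ≟ 0ℚ
... | yes _  = 0ℚ
... | no q≢0 = _÷_ p q {{≢-nonZero q≢0}}

pow2 : ℤ → ℚ
pow2 (+ n)      = (+ (2 ℕ.^ n)) Q./ 1
pow2 -[1+ n ]   = 1ℚ ÷₀ ((+ (2 ℕ.^ suc n)) Q./ 1)

two : ℚ
two = (+ 2) Q./ 1

Σ : ∀ {n} → (Fin n → ℚ) → ℚ
Σ {zero}  f = 0ℚ
Σ {suc n} f = f zero + Σ (λ i → f (suc i))

Max : ∀ {n} → (Fin (suc n) → ℚ) → ℚ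
Max {zero}  f = f zero
Max {suc n} f = f zero Q.⊔ Max (λ i → f (suc i))

count : ∀ {n} → (Fin n → Bool) → ℚ
count f = Σ (λ i → if f i then 1ℚ else 0ℚ)

anyL : List Bool → Bool
anyL = foldr _∨_ false

-- Level-Based Proportional Allocation.
-- Machines are Fin M with M = suc m' (so m = M ≥ 1); machine `zero`
-- is machine 1 (the fastest).  e i is the integer exponent with
-- s̄_i = 2 ^ (e i).

module LBPA {m' : ℕ} (e : Fin (suc m') → ℤ) where

  M : ℕ
  M = suc m'

  K : ℕ
  K = ⌊log₂ M ⌋ ℕ.+ 1

  levels : List ℕ
  levels = map suc (upTo K)

  s̄ : Fin M → ℚ
  s̄ i = pow2 (e i)

  r : ℕ → ℚ
  r k = s̄ zero ÷₀ ((+ (2 ℕ.^ (k ℕ.∸ 1))) Q./ 1)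

  inM : ℕ → Fin M → Bool
  inM k i = does (s̄ i ≟ r k)

  inM≤ : ℕ → Fin M → Bool
  inM≤ k i = anyL (map (λ k' → does (k' ℕ.≤? k) Data.Bool.∧ inM k' i) levels)

  kOf : ℚ → ℚ → ℕ
  kOf Λ p = foldr (λ k acc → if does (p ≤? (r k * Λ)) then k ⊔ acc else acc) 1 levels

  D : ℕ → ℚ
  D k = Σ (λ t → if inM≤ k t then s̄ t else 0ℚ)

  record State : Set where
    constructor st
    field
      Λ : ℚ
      C : Fin M → ℕ → ℚ

  zeroC : Fin M → ℕ → ℚ
  zeroC _ _ = 0ℚ

  doubleUntil : ℕ → ℚ → ℚ → ℚ
  doubleUntil zero     Λ t = Λ
  doubleUntil (suc f)  Λ t with does (t ≤? Λ)
  ... | true  = Λ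
  ... | false = doubleUntil f (two * Λ) t

  -- fuel: ⌈t / Λ⌉ + 1 doublings always suffice when Λ > 0
  fuel : ℚ → ℚ → ℕ
  fuel Λ t = ℤ.∣ ceiling (t ÷₀ Λ) ∣ ℕ.+ 1

  firstCol : Fin M → ℚ
  firstCol i = if inM 1 i then 1ℚ ÷₀ count (inM 1) else 0ℚ

  firstState : ℚ → State
  firstState p = st (p ÷₀ r 1) zeroC

  colOf : State → ℚ → Fin M → ℚ
  colOf (st Λ C) p i = if inM≤ k i then s̄ i ÷₀ D k else 0ℚ
    where k = kOf Λ p

  stepState : State → ℚ → State
  stepState (st Λ C) p =
    if does (k ℕ.<? K)
    then (if does (Λ <? (p ÷₀ r 1))
          then st (doubleUntil (fuel Λ (p ÷₀ r 1)) Λ (p ÷₀ r 1)) zeroC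
          else (if does (Λ <? C' zero k)
                then st (two * Λ) zeroC
                else st Λ C'))
    else st Λ C'
    where
      k = kOf Λ p
      x = colOf (st Λ C) p
      C' : Fin M → ℕ → ℚ
      C' i k' = if does (k' ℕ.≟ k) then C i k + ((x i * p) ÷₀ s̄ i) else C i k'

  runRest : State → List ℚ → List (Fin M → ℚ)
  runRest σ []       = []
  runRest σ (p ∷ ps) = colOf σ p ∷ runRest (stepState σ p) ps

  -- the fractional allocation X, as the list of its columns x_{·j}
  allocate : ℚ → List ℚ → List (Fin M → ℚ)
  allocate p₁ ps = firstCol ∷ runRest (firstState p₁) ps

obj : ∀ {m'} → (Fin (suc m') → ℚ) → List (Fin (suc m') → ℚ) → List ℚ → ℚ
obj s X ps = Max (λ i → foldr _+_ 0ℚ (zipWith (λ x p → (x i * p) ÷₀ s i) X ps))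

makespan : ∀ {m'} → (Fin (suc m') → ℚ) → (ps : List ℚ) → (Fin (length ps) → Fin (suc m')) → ℚ
makespan s ps σ =
  Max (λ i → Σ (λ j → if does (σ j FinP.≟ i) then lookup ps j else 0ℚ) ÷₀ s i)

module Submission where

-- Every job j of level k adds at most w = p_j / D_k to the speed-normalised load of any
-- machine (D_k = Σ_{t ∈ M_{≤k}} s̄_t), and w is exactly the increase of machine 1's counter
-- C_{1,k}; so every load is bounded by the total increase of machine 1's counters.  Counters
-- of the levels k < K stay below Λ and are reset whenever Λ doubles, so by the geometric
-- growth of Λ they contribute O(K · Λ); level-K jobs contribute their volume divided by D_K,
-- at most 6 OPT because the total speed is at most 6 D_K.  Finally Λ ≤ 8 OPT: it starts at
-- p_1 / s̄_1 ≤ 2 OPT, a raise to p_j / r_1 stays below 4 OPT, and a doubling forced by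
-- C_{1,k} > Λ requires more than Λ D_k volume of jobs larger than r_{k+1} Λ, whereas the
-- machines that could process such jobs within OPT have total speed below 2 D_k once Λ > 4 OPT.

open import Defs
open import Data.Bool using (Bool; true; false; if_then_else_; _∧_)
import Data.Bool.Properties as BoolP
open import Data.Empty using (⊥-elim)
open import Data.Fin as Fin using (Fin; zero; suc)
import Data.Fin.Properties as FinP
open import Data.Integer as ℤ using (ℤ; -[1+_])
open import Data.Integer.DivMod using ([n/d]*d≤n)
import Data.Integer.Properties as ℤP
open import Data.Integer.Tactic.RingSolver as ℤRing using ()
open import Data.List using (List; []; _∷_; length; lookup; foldr; map; upTo; zipWith)
import Data.List.Properties as ListP
open import Data.List.Membership.Propositional using (_∈_)
open import Data.List.Membership.Propositional.Properties using (∈-lookup; ∈-map⁺; ∈-map⁻; ∈-upTo⁺; ∈-upTo⁻)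
open import Data.List.Relation.Unary.All as All using (All; []; _∷_)
open import Data.List.Relation.Unary.Any using (here; there)
open import Data.Nat as ℕ using (ℕ; suc; zero; _^_; ⌊_/2⌋)
import Data.Nat.Properties as ℕP
open import Data.Nat.Logarithm using (⌊log₂_⌋)
open import Data.Nat.Logarithm.Core using (⌊log2⌋)
open import Data.Nat.Tactic.RingSolver as ℕRing using ()
open import Data.Product using (Σ-syntax; _×_; _,_; proj₁; proj₂; ∃)
open import Data.Rational as Q using (ℚ; 0ℚ; 1ℚ; _≤_; _<_; _*_; _/_; _+_; 1/_; positive; nonNegative; ≢-nonZero)
import Data.Rational.Properties as QP
open import Data.Rational.Properties using (_≟_; _<?_; _≤?_)
open import Data.Rational.Solver using (module +-*-Solver)
import Data.Rational.Unnormalised as U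
import Data.Rational.Unnormalised.Properties as UP
open import Induction.WellFounded using (Acc; acc)
open import Relation.Binary.PropositionalEquality
open import Relation.Nullary using (yes; no; does; Dec; ¬_)
open import Relation.Nullary.Decidable using (dec-true; dec-false)

open +-*-Solver

*-monoʳ-≤ : ∀ {p q} r → 0ℚ ≤ r → p ≤ q → p * r ≤ q * r
*-monoʳ-≤ r h = QP.*-monoʳ-≤-nonNeg r {{nonNegative h}}

*-monoˡ-≤ : ∀ {p q} r → 0ℚ ≤ r → p ≤ q → r * p ≤ r * q
*-monoˡ-≤ r h = QP.*-monoˡ-≤-nonNeg r {{nonNegative h}}

*-monoʳ-< : ∀ {p q} r → 0ℚ < r → p < q → p * r < q * r
*-monoʳ-< r h = QP.*-monoˡ-<-pos r {{positive h}}

*-monoˡ-< : ∀ {p q} r → 0ℚ < r → p < q → r * p < r * q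
*-monoˡ-< r h = QP.*-monoʳ-<-pos r {{positive h}}

*-cancelʳ-≤ : ∀ {p q} r → 0ℚ < r → p * r ≤ q * r → p ≤ q
*-cancelʳ-≤ r h = QP.*-cancelʳ-≤-pos r {{positive h}}

*-cancelʳ-< : ∀ {p q} r → 0ℚ ≤ r → p * r < q * r → p < q
*-cancelʳ-< r h = QP.*-cancelʳ-<-nonNeg r {{nonNegative h}}

*-cancelˡ-< : ∀ {p q} r → 0ℚ ≤ r → r * p < r * q → p < q
*-cancelˡ-< r h = QP.*-cancelˡ-<-nonNeg r {{nonNegative h}}

*-cancelʳ-≡ : ∀ {p q} r → 0ℚ < r → p * r ≡ q * r → p ≡ q
*-cancelʳ-≡ r h eq = QP.≤-antisym (*-cancelʳ-≤ r h (QP.≤-reflexive eq)) (*-cancelʳ-≤ r h (QP.≤-reflexive (sym eq)))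

*-nonNeg : ∀ {p q} → 0ℚ ≤ p → 0ℚ ≤ q → 0ℚ ≤ p * q
*-nonNeg {p} {q} hp hq = subst (_≤ p * q) (QP.*-zeroˡ q) (*-monoʳ-≤ q hq hp)

*-pos : ∀ {p q} → 0ℚ < p → 0ℚ < q → 0ℚ < p * q
*-pos {p} {q} hp hq = subst (_< p * q) (QP.*-zeroˡ q) (*-monoʳ-< q hq hp)

+-nonNeg : ∀ {p q} → 0ℚ ≤ p → 0ℚ ≤ q → 0ℚ ≤ p + q
+-nonNeg = QP.+-mono-≤

p≤p+q : ∀ {p} q → 0ℚ ≤ q → p ≤ p + q
p≤p+q {p} q h = subst (_≤ p + q) (QP.+-identityʳ p) (QP.+-monoʳ-≤ p h)

p≤q+p : ∀ {p} q → 0ℚ ≤ q → p ≤ q + p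
p≤q+p {p} q h = subst (_≤ q + p) (QP.+-identityˡ p) (QP.+-monoˡ-≤ p h)

÷₀-*-cancel : ∀ p {q} → 0ℚ < q → (p ÷₀ q) * q ≡ p
÷₀-*-cancel p {q} h with q ≟ 0ℚ
... | yes q≡0 = ⊥-elim (QP.<-irrefl (sym q≡0) h)
... | no q≢0 = begin
    p * 1/ q * q    ≡⟨ QP.*-assoc p (1/ q) q ⟩
    p * (1/ q * q)  ≡⟨ cong (p *_) (QP.*-inverseˡ q) ⟩
    p * 1ℚ          ≡⟨ QP.*-identityʳ p ⟩
    p               ∎
  where
  open ≡-Reasoning
  instance _ = ≢-nonZero q≢0

≤-÷₀ : ∀ {x} p {q} → 0ℚ < q → x * q ≤ p → x ≤ p ÷₀ q
≤-÷₀ p {q} h le = *-cancelʳ-≤ q h (subst (_ ≤_) (sym (÷₀-*-cancel p h)) le)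

÷₀-≤ : ∀ {x} p {q} → 0ℚ < q → p ≤ x * q → p ÷₀ q ≤ x
÷₀-≤ p {q} h le = *-cancelʳ-≤ q h (subst (_≤ _) (sym (÷₀-*-cancel p h)) le)

÷₀-unique : ∀ {x} p {q} → 0ℚ < q → x * q ≡ p → x ≡ p ÷₀ q
÷₀-unique p h eq = QP.≤-antisym (≤-÷₀ p h (QP.≤-reflexive eq)) (÷₀-≤ p h (QP.≤-reflexive (sym eq)))

÷₀-nonNeg : ∀ {p q} → 0ℚ ≤ p → 0ℚ < q → 0ℚ ≤ p ÷₀ q
÷₀-nonNeg {p} {q} hp hq = ≤-÷₀ p hq (subst (_≤ p) (sym (QP.*-zeroˡ q)) hp)

÷₀-pos : ∀ {p q} → 0ℚ < p → 0ℚ < q → 0ℚ < p ÷₀ q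
÷₀-pos {p} {q} hp hq =
  *-cancelʳ-< q (QP.<⇒≤ hq) (subst₂ _<_ (sym (QP.*-zeroˡ q)) (sym (÷₀-*-cancel p hq)) hp)

÷₀-antiʳ-≤ : ∀ {p a b} → 0ℚ ≤ p → 0ℚ < a → a ≤ b → p ÷₀ b ≤ p ÷₀ a
÷₀-antiʳ-≤ {p} {a} {b} hp ha ab = ÷₀-≤ p (QP.<-≤-trans ha ab)
  (subst (_≤ (p ÷₀ a) * b) (÷₀-*-cancel p ha) (*-monoˡ-≤ (p ÷₀ a) (÷₀-nonNeg hp ha) ab))

fromℕ : ℕ → ℚ
fromℕ n = ℤ.+ n / 1

private
  toℚᵘ-fromℕ : ∀ n → Q.toℚᵘ (fromℕ n) U.≃ U.mkℚᵘ (ℤ.+ n) 0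
  toℚᵘ-fromℕ n = QP.toℚᵘ-fromℚᵘ (U.mkℚᵘ (ℤ.+ n) 0)

fromℕ-* : ∀ a b → fromℕ (a ℕ.* b) ≡ fromℕ a * fromℕ b
fromℕ-* a b = QP.toℚᵘ-injective (UP.≃-trans (toℚᵘ-fromℕ (a ℕ.* b)) (UP.≃-trans unnormalised
  (UP.≃-sym (UP.≃-trans (QP.toℚᵘ-homo-* (fromℕ a) (fromℕ b)) (UP.*-cong (toℚᵘ-fromℕ a) (toℚᵘ-fromℕ b))))))
  where
  unnormalised : U.mkℚᵘ (ℤ.+ (a ℕ.* b)) 0 U.≃ U.mkℚᵘ (ℤ.+ a) 0 U.* U.mkℚᵘ (ℤ.+ b) 0
  unnormalised = U.*≡* (cong (ℤ._* ℤ.1ℤ) (ℤP.pos-* a b))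

fromℕ-+ : ∀ a b → fromℕ (a ℕ.+ b) ≡ fromℕ a + fromℕ b
fromℕ-+ a b = QP.toℚᵘ-injective (UP.≃-trans (toℚᵘ-fromℕ (a ℕ.+ b)) (UP.≃-trans unnormalised
  (UP.≃-sym (UP.≃-trans (QP.toℚᵘ-homo-+ (fromℕ a) (fromℕ b)) (UP.+-cong (toℚᵘ-fromℕ a) (toℚᵘ-fromℕ b))))))
  where
  unnormalised : U.mkℚᵘ (ℤ.+ (a ℕ.+ b)) 0 U.≃ U.mkℚᵘ (ℤ.+ a) 0 U.+ U.mkℚᵘ (ℤ.+ b) 0
  unnormalised = U.*≡* (cong (ℤ._* ℤ.1ℤ) (trans (ℤP.pos-+ a b)
    (sym (cong₂ ℤ._+_ (ℤP.*-identityʳ (ℤ.+ a)) (ℤP.*-identityʳ (ℤ.+ b))))))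

fromℕ-nonNeg : ∀ n → 0ℚ ≤ fromℕ n
fromℕ-nonNeg n = QP.nonNegative⁻¹ _ {{QP.normalize-nonNeg n 1}}

fromℕ-mono-≤ : ∀ {a b} → a ℕ.≤ b → fromℕ a ≤ fromℕ b
fromℕ-mono-≤ {a} {b} h = subst (λ z → fromℕ a ≤ fromℕ z) (ℕP.m+[n∸m]≡n h)
  (subst (fromℕ a ≤_) (sym (fromℕ-+ a (b ℕ.∸ a))) (p≤p+q (fromℕ (b ℕ.∸ a)) (fromℕ-nonNeg (b ℕ.∸ a))))

fromℕ-pos : ∀ {n} → 0 ℕ.< n → 0ℚ < fromℕ n
fromℕ-pos h = QP.<-≤-trans (QP.positive⁻¹ 1ℚ) (fromℕ-mono-≤ h)

≤fromℕ∣ceiling∣ : ∀ q → q ≤ fromℕ ℤ.∣ Q.ceiling q ∣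
≤fromℕ∣ceiling∣ q@(Q.mkℚ _ _ _) =
  QP.toℚᵘ-cancel-≤ (UP.≤-respʳ-≃ (UP.≃-sym (toℚᵘ-fromℕ ∣c∣)) (U.*≤* (subst (ℤ._≤ ℤ.+ ∣c∣ ℤ.* Q.↧ q)
    (sym (ℤP.*-identityʳ (Q.↥ q))) (ℤP.≤-trans (↥≤ceiling*↧ q) (ℤP.*-monoʳ-≤-nonNeg (Q.↧ q) (i≤+∣i∣ c))))))
  where
  c = Q.ceiling q
  ∣c∣ = ℤ.∣ c ∣
  i≤+∣i∣ : ∀ i → i ℤ.≤ ℤ.+ ℤ.∣ i ∣
  i≤+∣i∣ (ℤ.+ n) = ℤP.≤-refl
  i≤+∣i∣ -[1+ n ] = ℤ.-≤+
  ≤-neg[neg/d]*d : ∀ n d .{{_ : ℤ.NonZero d}} → n ℤ.≤ (ℤ.- ((ℤ.- n) ℤ./ d)) ℤ.* d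
  ≤-neg[neg/d]*d n d = subst₂ ℤ._≤_ (ℤP.neg-involutive n) (ℤP.neg-distribˡ-* ((ℤ.- n) ℤ./ d) d)
    (ℤP.neg-mono-≤ ([n/d]*d≤n (ℤ.- n) d))
  -- the numerator is split only so that the negation inside ceiling reduces
  ↥≤ceiling*↧ : ∀ q → Q.↥ q ℤ.≤ Q.ceiling q ℤ.* Q.↧ q
  ↥≤ceiling*↧ (Q.mkℚ -[1+ k ] d _)    = ≤-neg[neg/d]*d -[1+ k ] (ℤ.+ suc d)
  ↥≤ceiling*↧ (Q.mkℚ (ℤ.+ zero) d _)  = ≤-neg[neg/d]*d (ℤ.+ zero) (ℤ.+ suc d)
  ↥≤ceiling*↧ (Q.mkℚ (ℤ.+ suc k) d _) = ≤-neg[neg/d]*d (ℤ.+ suc k) (ℤ.+ suc d)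

1<two : 1ℚ < two
1<two = Q.*<* (ℤ.+<+ (ℕ.s≤s (ℕ.s≤s ℕ.z≤n)))

two-pos : 0ℚ < two
two-pos = fromℕ-pos {2} (ℕ.s≤s ℕ.z≤n)

two-nonNeg : 0ℚ ≤ two
two-nonNeg = QP.<⇒≤ two-pos

p<two*p : ∀ {p} → 0ℚ < p → p < two * p
p<two*p {p} h = subst (_< two * p) (QP.*-identityˡ p) (*-monoʳ-< p h 1<two)

p≤two*p : ∀ {p} → 0ℚ ≤ p → p ≤ two * p
p≤two*p {p} h = subst (_≤ two * p) (QP.*-identityˡ p) (*-monoʳ-≤ p h (QP.<⇒≤ 1<two))

2^n>0 : ∀ n → 0 ℕ.< 2 ^ n
2^n>0 = ℕP.m^n>0 2

n<2^n : ∀ n → n ℕ.< 2 ^ n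
n<2^n zero = ℕ.s≤s ℕ.z≤n
n<2^n (suc n) = ℕP.+-mono-≤ (2^n>0 n) (ℕP.≤-trans (n<2^n n) (ℕP.m≤m+n (2 ^ n) 0))

fromℕ-2^suc : ∀ n → fromℕ (2 ^ suc n) ≡ two * fromℕ (2 ^ n)
fromℕ-2^suc n = fromℕ-* 2 (2 ^ n)

1≤fromℕ-2^ : ∀ n → 1ℚ ≤ fromℕ (2 ^ n)
1≤fromℕ-2^ n = fromℕ-mono-≤ (2^n>0 n)

fromℕ-2^-pos : ∀ n → 0ℚ < fromℕ (2 ^ n)
fromℕ-2^-pos n = fromℕ-pos (2^n>0 n)

pow2-pos : ∀ a → 0ℚ < pow2 a
pow2-pos (ℤ.+ n) = fromℕ-2^-pos n
pow2-pos -[1+ n ] = ÷₀-pos (QP.positive⁻¹ 1ℚ) (fromℕ-2^-pos (suc n))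

pow2-suc : ∀ a → pow2 (a ℤ.+ ℤ.+ 1) ≡ two * pow2 a
pow2-suc (ℤ.+ n) = trans (cong (λ z → fromℕ (2 ^ z)) (ℕP.+-comm n 1)) (fromℕ-2^suc n)
pow2-suc -[1+ 0 ] = refl
pow2-suc -[1+ suc n ] = sym (÷₀-unique 1ℚ (fromℕ-2^-pos (suc n)) (begin
    two * y * fromℕ (2 ^ suc n)    ≡⟨ solve 3 (λ t y q → t :* y :* q := y :* (t :* q)) refl two y _ ⟩
    y * (two * fromℕ (2 ^ suc n))  ≡⟨ cong (y *_) (sym (fromℕ-2^suc (suc n))) ⟩
    y * fromℕ (2 ^ suc (suc n))    ≡⟨ ÷₀-*-cancel 1ℚ (fromℕ-2^-pos (suc (suc n))) ⟩
    1ℚ                             ∎))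
  where
  open ≡-Reasoning
  y = 1ℚ ÷₀ fromℕ (2 ^ suc (suc n))

pow2-+ : ∀ a n → pow2 (a ℤ.+ ℤ.+ n) ≡ pow2 a * fromℕ (2 ^ n)
pow2-+ a zero = trans (cong pow2 (ℤP.+-identityʳ a)) (sym (QP.*-identityʳ (pow2 a)))
pow2-+ a (suc n) = begin
    pow2 (a ℤ.+ ℤ.+ suc n)             ≡⟨ cong pow2 (shift a (ℤ.+ n)) ⟩
    pow2 ((a ℤ.+ ℤ.+ n) ℤ.+ ℤ.+ 1)     ≡⟨ pow2-suc (a ℤ.+ ℤ.+ n) ⟩
    two * pow2 (a ℤ.+ ℤ.+ n)           ≡⟨ cong (two *_) (pow2-+ a n) ⟩
    two * (pow2 a * fromℕ (2 ^ n))     ≡⟨ solve 3 (λ t x y → t :* (x :* y) := x :* (t :* y)) refl two (pow2 a) _ ⟩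
    pow2 a * (two * fromℕ (2 ^ n))     ≡⟨ cong (pow2 a *_) (sym (fromℕ-2^suc n)) ⟩
    pow2 a * fromℕ (2 ^ suc n)         ∎
  where
  open ≡-Reasoning
  shift : ∀ a b → a ℤ.+ (ℤ.+ 1 ℤ.+ b) ≡ (a ℤ.+ b) ℤ.+ ℤ.+ 1
  shift = ℤRing.solve-∀

pow2-mono-≤ : ∀ {a b} → a ℤ.≤ b → pow2 a ≤ pow2 b
pow2-mono-≤ {a} {b} h = subst (λ z → pow2 a ≤ pow2 z) a+n≡b
    (subst (_≤ pow2 (a ℤ.+ ℤ.+ n)) (QP.*-identityʳ (pow2 a))
      (subst (pow2 a * 1ℚ ≤_) (sym (pow2-+ a n)) (*-monoˡ-≤ (pow2 a) (QP.<⇒≤ (pow2-pos a)) (1≤fromℕ-2^ n))))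
  where
  n = ℤ.∣ b ℤ.- a ∣
  i+[j-i]≡j : ∀ i j → i ℤ.+ (j ℤ.- i) ≡ j
  i+[j-i]≡j = ℤRing.solve-∀
  a+n≡b : a ℤ.+ ℤ.+ n ≡ b
  a+n≡b = trans (cong (λ z → a ℤ.+ z) (ℤP.0≤i⇒+∣i∣≡i (ℤP.i≤j⇒0≤j-i h))) (i+[j-i]≡j a b)

pow2-cancel-≤ : ∀ {a b} → pow2 a ≤ pow2 b → a ℤ.≤ b
pow2-cancel-≤ {a} {b} h with a ℤP.≤? b
... | yes a≤b = a≤b
... | no a≰b = ⊥-elim (QP.<-irrefl refl (QP.<-≤-trans (p<two*p (pow2-pos b)) (QP.≤-trans 2b≤a h)))
  where
  2b≤a : two * pow2 b ≤ pow2 a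
  2b≤a = subst (_≤ pow2 a) (trans (cong pow2 (ℤP.+-comm (ℤ.+ 1) b)) (pow2-suc b))
           (pow2-mono-≤ (ℤP.i<j⇒suc[i]≤j (ℤP.≰⇒> a≰b)))

n<2^[⌊log2⌋n+1] : ∀ n (rec : Acc ℕ._<_ n) → n ℕ.< 2 ^ (⌊log2⌋ n rec ℕ.+ 1)
n<2^[⌊log2⌋n+1] zero _ = ℕ.s≤s ℕ.z≤n
n<2^[⌊log2⌋n+1] (suc zero) _ = ℕ.s≤s (ℕ.s≤s ℕ.z≤n)
n<2^[⌊log2⌋n+1] (suc (suc n)) (acc rs) = ℕP.≤-trans (ℕ.s≤s (ℕ.s≤s (ℕ.s≤s (n≤2⌊n/2⌋+1 n))))
    (ℕP.≤-trans (ℕP.≤-reflexive (regroup ⌊ n /2⌋)) (ℕP.+-mono-≤ ih (ℕP.≤-trans ih (ℕP.m≤m+n _ 0))))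
  where
  ih = n<2^[⌊log2⌋n+1] (suc ⌊ n /2⌋) (rs (ℕP.⌊n/2⌋<n (suc n)))
  n≤2⌊n/2⌋+1 : ∀ n → n ℕ.≤ ⌊ n /2⌋ ℕ.+ ⌊ n /2⌋ ℕ.+ 1
  n≤2⌊n/2⌋+1 zero = ℕ.z≤n
  n≤2⌊n/2⌋+1 (suc zero) = ℕ.s≤s ℕ.z≤n
  n≤2⌊n/2⌋+1 (suc (suc n)) rewrite ℕP.+-suc ⌊ n /2⌋ ⌊ n /2⌋ = ℕ.s≤s (ℕ.s≤s (n≤2⌊n/2⌋+1 n))
  regroup : ∀ h → 3 ℕ.+ (h ℕ.+ h ℕ.+ 1) ≡ suc (suc h) ℕ.+ suc (suc h)
  regroup = ℕRing.solve-∀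

if-dec : ∀ {a} {X : Set a} {A : Set} (P : A → Set) (d : Dec X) {x y : A} →
         (X → P x) → (¬ X → P y) → P (if does d then x else y)
if-dec P (yes x) f g = f x
if-dec P (no ¬x) f g = g ¬x

if-bool : ∀ {A : Set} (P : A → Set) (b : Bool) {x y : A} →
          (b ≡ true → P x) → (b ≡ false → P y) → P (if b then x else y)
if-bool P true f g = f refl
if-bool P false f g = g refl

true≢false : true ≢ false
true≢false ()

does-true : ∀ {a} {X : Set a} (d : Dec X) → does d ≡ true → X
does-true (yes x) _ = x

does-false : ∀ {a} {X : Set a} (d : Dec X) → does d ≡ false → ¬ X
does-false (no ¬x) _ = ¬x

Σ-cong : ∀ {n} {f g : Fin n → ℚ} → (∀ i → f i ≡ g i) → Σ f ≡ Σ g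
Σ-cong {zero} h = refl
Σ-cong {suc n} h = cong₂ _+_ (h zero) (Σ-cong (λ i → h (suc i)))

Σ-mono-≤ : ∀ {n} {f g : Fin n → ℚ} → (∀ i → f i ≤ g i) → Σ f ≤ Σ g
Σ-mono-≤ {zero} h = QP.≤-refl
Σ-mono-≤ {suc n} h = QP.+-mono-≤ (h zero) (Σ-mono-≤ (λ i → h (suc i)))

Σ-zero : ∀ n → Σ {n} (λ _ → 0ℚ) ≡ 0ℚ
Σ-zero zero = refl
Σ-zero (suc n) = trans (QP.+-identityˡ _) (Σ-zero n)

Σ-nonNeg : ∀ {n} {f : Fin n → ℚ} → (∀ i → 0ℚ ≤ f i) → 0ℚ ≤ Σ f
Σ-nonNeg {n} {f} h = subst (_≤ Σ f) (Σ-zero n) (Σ-mono-≤ h)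

Σ-+ : ∀ {n} (f g : Fin n → ℚ) → Σ (λ i → f i + g i) ≡ Σ f + Σ g
Σ-+ {zero} f g = refl
Σ-+ {suc n} f g = trans (cong ((f zero + g zero) +_) (Σ-+ (λ i → f (suc i)) (λ i → g (suc i))))
  (solve 4 (λ a b c d → (a :+ b) :+ (c :+ d) := (a :+ c) :+ (b :+ d)) refl (f zero) (g zero) _ _)

Σ-*ˡ : ∀ {n} c (f : Fin n → ℚ) → Σ (λ i → c * f i) ≡ c * Σ f
Σ-*ˡ {zero} c f = sym (QP.*-zeroʳ c)
Σ-*ˡ {suc n} c f = trans (cong ((c * f zero) +_) (Σ-*ˡ c (λ i → f (suc i))))
  (sym (QP.*-distribˡ-+ c (f zero) _))

Σ-const : ∀ n c → Σ {n} (λ _ → c) ≡ fromℕ n * c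
Σ-const zero c = sym (QP.*-zeroˡ c)
Σ-const (suc n) c = begin
    c + Σ {n} (λ _ → c)   ≡⟨ cong (c +_) (Σ-const n c) ⟩
    c + fromℕ n * c       ≡⟨ solve 2 (λ c x → c :+ x :* c := (con 1ℚ :+ x) :* c) refl c (fromℕ n) ⟩
    (1ℚ + fromℕ n) * c    ≡⟨ cong (_* c) (sym (fromℕ-+ 1 n)) ⟩
    fromℕ (suc n) * c     ∎
  where open ≡-Reasoning

Σ-swap : ∀ {n m} (f : Fin n → Fin m → ℚ) → Σ (λ i → Σ (λ j → f i j)) ≡ Σ (λ j → Σ (λ i → f i j))
Σ-swap {zero} {m} f = sym (Σ-zero m)
Σ-swap {suc n} f = trans (cong (Σ (f zero) +_) (Σ-swap (λ i → f (suc i))))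
  (sym (Σ-+ (f zero) (λ j → Σ (λ i → f (suc i) j))))

f≤Σf : ∀ {n} {f : Fin n → ℚ} → (∀ i → 0ℚ ≤ f i) → ∀ i → f i ≤ Σ f
f≤Σf h zero = p≤p+q _ (Σ-nonNeg (λ i → h (suc i)))
f≤Σf h (suc i) = QP.≤-trans (f≤Σf (λ i → h (suc i)) i) (p≤q+p _ (h zero))

Σ-indicator : ∀ {n} (a : Fin n) x → Σ (λ i → if does (a FinP.≟ i) then x else 0ℚ) ≡ x
Σ-indicator {suc n} zero x = trans (cong (x +_) (Σ-zero n)) (QP.+-identityʳ x)
Σ-indicator {suc n} (suc a) x = trans (QP.+-identityˡ _) (Σ-indicator a x)

Σ-lookup : ∀ (f : ℚ → ℚ) (L : List ℚ) → Σ {length L} (λ j → f (lookup L j)) ≡ foldr (λ p acc → f p + acc) 0ℚ L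
Σ-lookup f [] = refl
Σ-lookup f (p ∷ L) = cong (f p +_) (Σ-lookup f L)

Max-lub : ∀ {n} {f : Fin (suc n) → ℚ} {b} → (∀ i → f i ≤ b) → Max f ≤ b
Max-lub {zero} h = h zero
Max-lub {suc n} h = QP.⊔-lub (h zero) (Max-lub (λ i → h (suc i)))

f≤Maxf : ∀ {n} (f : Fin (suc n) → ℚ) i → f i ≤ Max f
f≤Maxf {zero} f zero = QP.≤-refl
f≤Maxf {suc n} f zero = QP.p≤p⊔q (f zero) _
f≤Maxf {suc n} f (suc i) = QP.≤-trans (f≤Maxf (λ i → f (suc i)) i) (QP.p≤q⊔p (f zero) _)

sumOver : List ℕ → (ℕ → ℚ) → ℚ
sumOver ks f = foldr (λ k acc → f k + acc) 0ℚ ks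

sumOver-zero : ∀ ks → sumOver ks (λ _ → 0ℚ) ≡ 0ℚ
sumOver-zero [] = refl
sumOver-zero (k ∷ ks) = trans (QP.+-identityˡ _) (sumOver-zero ks)

sumOver-mono-≤ : ∀ ks {f g : ℕ → ℚ} → (∀ k → f k ≤ g k) → sumOver ks f ≤ sumOver ks g
sumOver-mono-≤ [] h = QP.≤-refl
sumOver-mono-≤ (k ∷ ks) h = QP.+-mono-≤ (h k) (sumOver-mono-≤ ks h)

sumOver-bump : ∀ ks {f g : ℕ → ℚ} {k δ} → k ∈ ks → (∀ k → f k ≤ g k) → f k + δ ≤ g k →
               sumOver ks f + δ ≤ sumOver ks g
sumOver-bump (k ∷ ks) {f} {g} {δ = δ} (here refl) f≤g fk+δ≤gk = begin
  f k + sumOver ks f + δ   ≡⟨ solve 3 (λ a b d → a :+ b :+ d := (a :+ d) :+ b) refl (f k) (sumOver ks f) δ ⟩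
  f k + δ + sumOver ks f   ≤⟨ QP.+-mono-≤ fk+δ≤gk (sumOver-mono-≤ ks f≤g) ⟩
  g k + sumOver ks g       ∎
  where open QP.≤-Reasoning
sumOver-bump (k ∷ ks) {f} {g} {δ = δ} (there j∈) f≤g fj+δ≤gj = begin
  f k + sumOver ks f + δ     ≡⟨ QP.+-assoc (f k) (sumOver ks f) δ ⟩
  f k + (sumOver ks f + δ)   ≤⟨ QP.+-mono-≤ (f≤g k) (sumOver-bump ks j∈ f≤g fj+δ≤gj) ⟩
  g k + sumOver ks g         ∎
  where open QP.≤-Reasoning

sumOver-≤ : ∀ ks {f : ℕ → ℚ} {b} → (∀ {k} → k ∈ ks → f k ≤ b) → sumOver ks f ≤ fromℕ (length ks) * b
sumOver-≤ [] {b = b} h = QP.≤-reflexive (sym (QP.*-zeroˡ b))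
sumOver-≤ (k ∷ ks) {f} {b} h = begin
  f k + sumOver ks f                ≤⟨ QP.+-mono-≤ (h (here refl)) (sumOver-≤ ks (λ k∈ → h (there k∈))) ⟩
  b + fromℕ (length ks) * b         ≡⟨ solve 2 (λ b n → b :+ n :* b := (con 1ℚ :+ n) :* b) refl b (fromℕ (length ks)) ⟩
  (1ℚ + fromℕ (length ks)) * b      ≡⟨ cong (_* b) (sym (fromℕ-+ 1 (length ks))) ⟩
  fromℕ (suc (length ks)) * b       ∎
  where open QP.≤-Reasoning

-- The volume lower bound on the optimal makespan

large : ℚ → ℚ → ℚ
large θ p = if does (θ <? p) then p else 0ℚ

heavy : List ℚ → ℚ → ℚ
heavy L θ = foldr (λ p acc → large θ p + acc) 0ℚ L

capacity : ∀ {m'} → (Fin (suc m') → ℚ) → ℚ → ℚ → ℚ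
capacity s T θ = Σ (λ i → if does (θ <? s i * T) then s i else 0ℚ)

large-≤ : ∀ θ {p} → 0ℚ ≤ p → large θ p ≤ p
large-≤ θ {p} h = if-dec (_≤ p) (θ <? p) (λ _ → QP.≤-refl) (λ _ → h)

large-nonNeg : ∀ θ {p} → 0ℚ ≤ p → 0ℚ ≤ large θ p
large-nonNeg θ {p} h = if-dec (0ℚ ≤_) (θ <? p) (λ _ → h) (λ _ → QP.≤-refl)

large-> : ∀ {θ p} → θ < p → large θ p ≡ p
large-> {θ} {p} lt = cong (λ b → if b then p else 0ℚ) (dec-true (θ <? p) lt)

heavy-nonNeg : ∀ {L} θ → All (0ℚ ≤_) L → 0ℚ ≤ heavy L θ
heavy-nonNeg θ [] = QP.≤-refl
heavy-nonNeg θ (h ∷ hs) = +-nonNeg (large-nonNeg θ h) (heavy-nonNeg θ hs)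

module _ {m'} (s : Fin (suc m') → ℚ) (s-pos : ∀ i → 0ℚ < s i)
         {L : List ℚ} (L-nonNeg : All (0ℚ ≤_) L) (σ : Fin (length L) → Fin (suc m')) where

  private
    T = makespan s L σ

    assigned : Fin (suc m') → (ℚ → ℚ) → Fin (length L) → ℚ
    assigned i f j = if does (σ j FinP.≟ i) then f (lookup L j) else 0ℚ

    load : Fin (suc m') → ℚ
    load i = Σ (assigned i (λ p → p))

    job-nonNeg : ∀ j → 0ℚ ≤ lookup L j
    job-nonNeg j = All.lookup L-nonNeg (∈-lookup j)

    assigned-nonNeg : ∀ i j → 0ℚ ≤ assigned i (λ p → p) j
    assigned-nonNeg i j = if-dec (0ℚ ≤_) (σ j FinP.≟ i) (λ _ → job-nonNeg j) (λ _ → QP.≤-refl)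

    load≤T*s : ∀ i → load i ≤ T * s i
    load≤T*s i = subst (_≤ T * s i) (÷₀-*-cancel (load i) (s-pos i))
      (*-monoʳ-≤ (s i) (QP.<⇒≤ (s-pos i)) (f≤Maxf (λ i → load i ÷₀ s i) i))

    job≤load : ∀ j → lookup L j ≤ load (σ j)
    job≤load j = subst (_≤ load (σ j))
      (cong (λ b → if b then lookup L j else 0ℚ) (dec-true (σ j FinP.≟ σ j) refl))
      (f≤Σf (assigned-nonNeg (σ j)) j)

    -- A job larger than θ sits on a machine i with θ < s i * T, whose load is at most s i * T.
    heavy-load≤ : ∀ θ i → Σ (assigned i (large θ)) ≤ T * (if does (θ <? s i * T) then s i else 0ℚ)
    heavy-load≤ θ i = if-dec (λ c → Σ (assigned i (large θ)) ≤ T * c) (θ <? s i * T)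
      (λ _ → QP.≤-trans (Σ-mono-≤ large≤job) (load≤T*s i))
      (λ θ≮sT → QP.≤-trans (Σ-mono-≤ (no-large θ≮sT)) (QP.≤-reflexive (trans (Σ-zero (length L)) (sym (QP.*-zeroʳ T)))))
      where
      large≤job : ∀ j → assigned i (large θ) j ≤ assigned i (λ p → p) j
      large≤job j with does (σ j FinP.≟ i)
      ... | true = large-≤ θ (job-nonNeg j)
      ... | false = QP.≤-refl
      no-large : ¬ (θ < s i * T) → ∀ j → assigned i (large θ) j ≤ 0ℚ
      no-large θ≮sT j = if-dec (_≤ 0ℚ) (σ j FinP.≟ i)
        (λ { refl → if-dec (_≤ 0ℚ) (θ <? lookup L j)
               (λ θ<p → ⊥-elim (θ≮sT (QP.<-≤-trans θ<p (QP.≤-trans (job≤load j)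
                 (subst (load (σ j) ≤_) (QP.*-comm T (s (σ j))) (load≤T*s (σ j)))))))
               (λ _ → QP.≤-refl) })
        (λ _ → QP.≤-refl)

  makespan-nonNeg : 0ℚ ≤ makespan s L σ
  makespan-nonNeg = QP.≤-trans (÷₀-nonNeg (Σ-nonNeg (assigned-nonNeg zero)) (s-pos zero))
    (f≤Maxf (λ i → load i ÷₀ s i) zero)

  heavy≤makespan*capacity : ∀ θ → heavy L θ ≤ makespan s L σ * capacity s (makespan s L σ) θ
  heavy≤makespan*capacity θ = begin
    heavy L θ                                        ≡⟨ sym (Σ-lookup (large θ) L) ⟩
    Σ (λ j → large θ (lookup L j))                   ≡⟨ Σ-cong (λ j → sym (Σ-indicator (σ j) _)) ⟩
    Σ (λ j → Σ (λ i → assigned i (large θ) j))       ≡⟨ Σ-swap (λ j i → assigned i (large θ) j) ⟩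
    Σ (λ i → Σ (assigned i (large θ)))               ≤⟨ Σ-mono-≤ (heavy-load≤ θ) ⟩
    Σ (λ i → T * (if does (θ <? s i * T) then s i else 0ℚ)) ≡⟨ Σ-*ˡ T (λ i → if does (θ <? s i * T) then s i else 0ℚ) ⟩
    T * capacity s T θ                               ∎
    where open QP.≤-Reasoning

-- Levels and thresholds of the algorithm

maxWhere : (ℕ → Bool) → List ℕ → ℕ
maxWhere c = foldr (λ k acc → if c k then k ℕ.⊔ acc else acc) 1

maxWhere-≥1 : ∀ c xs → 1 ℕ.≤ maxWhere c xs
maxWhere-≥1 c [] = ℕP.≤-refl
maxWhere-≥1 c (x ∷ xs) with c x
... | true = ℕP.≤-trans (maxWhere-≥1 c xs) (ℕP.m≤n⊔m x _)
... | false = maxWhere-≥1 c xs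

maxWhere-lub : ∀ c xs {b} → (∀ {x} → x ∈ xs → x ℕ.≤ b) → 1 ℕ.≤ b → maxWhere c xs ℕ.≤ b
maxWhere-lub c [] h 1≤b = 1≤b
maxWhere-lub c (x ∷ xs) h 1≤b with c x
... | true = ℕP.⊔-lub (h (here refl)) (maxWhere-lub c xs (λ m → h (there m)) 1≤b)
... | false = maxWhere-lub c xs (λ m → h (there m)) 1≤b

maxWhere-upper : ∀ c xs {x} → x ∈ xs → c x ≡ true → x ℕ.≤ maxWhere c xs
maxWhere-upper c (y ∷ xs) (here refl) cx rewrite cx = ℕP.m≤m⊔n y _
maxWhere-upper c (y ∷ xs) (there x∈xs) cx with c y
... | true = ℕP.≤-trans (maxWhere-upper c xs x∈xs cx) (ℕP.m≤n⊔m y _)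
... | false = maxWhere-upper c xs x∈xs cx

module Thresholds {m'} (e : Fin (suc m') → ℤ) where

  open LBPA e

  1≤K : 1 ℕ.≤ K
  1≤K = subst (1 ℕ.≤_) (ℕP.+-comm 1 ⌊log₂ M ⌋) (ℕ.s≤s ℕ.z≤n)

  ∈levels⇒≤K : ∀ {k} → k ∈ levels → k ℕ.≤ K
  ∈levels⇒≤K k∈ with ∈-map⁻ suc k∈
  ... | _ , j∈ , refl = ∈-upTo⁻ j∈

  kOf-≥1 : ∀ Λ p → 1 ℕ.≤ kOf Λ p
  kOf-≥1 Λ p = maxWhere-≥1 (λ k → does (p ≤? r k * Λ)) levels

  kOf-≤K : ∀ Λ p → kOf Λ p ℕ.≤ K
  kOf-≤K Λ p = maxWhere-lub (λ k → does (p ≤? r k * Λ)) levels ∈levels⇒≤K 1≤K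

  kOf-maximal : ∀ Λ p → kOf Λ p ℕ.< K → r (suc (kOf Λ p)) * Λ < p
  kOf-maximal Λ p k<K = QP.≰⇒> λ p≤ → ℕP.<-irrefl refl
    (maxWhere-upper (λ k → does (p ≤? r k * Λ)) levels (∈-map⁺ suc (∈-upTo⁺ k<K))
      (dec-true (p ≤? r (suc (kOf Λ p)) * Λ) p≤))

  -- levels 1 … K-1: only their counters can trigger a doubling of Λ
  lowerLevels : List ℕ
  lowerLevels = map suc (upTo ⌊log₂ M ⌋)

  ∈lowerLevels⇒<K : ∀ {k} → k ∈ lowerLevels → k ℕ.< K
  ∈lowerLevels⇒<K k∈ with ∈-map⁻ suc k∈
  ... | j , j∈ , refl = subst (suc (suc j) ℕ.≤_) (ℕP.+-comm 1 ⌊log₂ M ⌋) (ℕ.s≤s (∈-upTo⁻ j∈))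

  <K⇒∈lowerLevels : ∀ {k} → 1 ℕ.≤ k → k ℕ.< K → k ∈ lowerLevels
  <K⇒∈lowerLevels {suc j} _ k<K =
    ∈-map⁺ suc (∈-upTo⁺ (ℕ.s≤s⁻¹ (subst (suc (suc j) ℕ.≤_) (ℕP.+-comm ⌊log₂ M ⌋ 1) k<K)))

  length-lowerLevels : length lowerLevels ≡ ⌊log₂ M ⌋
  length-lowerLevels = trans (ListP.length-map suc (upTo ⌊log₂ M ⌋)) (ListP.length-upTo ⌊log₂ M ⌋)

  private
    doubleUntil-≥start : ∀ f {Λ} t → 0ℚ < Λ → Λ ≤ doubleUntil f Λ t
    doubleUntil-≥start zero t _ = QP.≤-refl
    doubleUntil-≥start (suc f) {Λ} t Λ>0 with does (t ≤? Λ)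
    ... | true = QP.≤-refl
    ... | false = QP.≤-trans (QP.<⇒≤ (p<two*p Λ>0)) (doubleUntil-≥start f t (*-pos two-pos Λ>0))

    doubleUntil-≤two*t : ∀ f {Λ} t → 0ℚ < Λ → Λ ≤ two * t → doubleUntil f Λ t ≤ two * t
    doubleUntil-≤two*t zero t _ Λ≤2t = Λ≤2t
    doubleUntil-≤two*t (suc f) {Λ} t Λ>0 Λ≤2t with does (t ≤? Λ) in t≤?Λ
    ... | true = Λ≤2t
    ... | false = doubleUntil-≤two*t f t (*-pos two-pos Λ>0)
      (*-monoˡ-≤ two two-nonNeg (QP.<⇒≤ (QP.≰⇒> (does-false (t ≤? Λ) t≤?Λ))))

    doubleUntil-≥target : ∀ f {Λ} t → 0ℚ < Λ → t ≤ fromℕ (2 ^ f) * Λ → t ≤ doubleUntil f Λ t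
    doubleUntil-≥target zero {Λ} t _ t≤Λ = subst (t ≤_) (QP.*-identityˡ Λ) t≤Λ
    doubleUntil-≥target (suc f) {Λ} t Λ>0 t≤2^fΛ with does (t ≤? Λ) in t≤?Λ
    ... | true = does-true (t ≤? Λ) t≤?Λ
    ... | false = doubleUntil-≥target f t (*-pos two-pos Λ>0) (subst (t ≤_)
      (trans (cong (_* Λ) (fromℕ-2^suc f)) (solve 3 (λ a b c → a :* b :* c := b :* (a :* c)) refl two (fromℕ (2 ^ f)) Λ)) t≤2^fΛ)

  raise-≥ : ∀ {Λ} t → 0ℚ < Λ → t ≤ doubleUntil (fuel Λ t) Λ t
  raise-≥ {Λ} t Λ>0 = doubleUntil-≥target (fuel Λ t) t Λ>0
    (subst (_≤ fromℕ (2 ^ fuel Λ t) * Λ) (÷₀-*-cancel t Λ>0) (*-monoʳ-≤ Λ (QP.<⇒≤ Λ>0)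
      (QP.≤-trans (≤fromℕ∣ceiling∣ (t ÷₀ Λ)) (fromℕ-mono-≤ (ℕP.≤-trans (ℕP.<⇒≤ (n<2^n c))
        (ℕP.≤-trans (ℕP.m≤m+n (2 ^ c) _) (ℕP.≤-reflexive (cong (2 ^_) (ℕP.+-comm 1 c)))))))))
    where c = ℤ.∣ Q.ceiling (t ÷₀ Λ) ∣

  raise-≥two*Λ : ∀ {Λ t} → 0ℚ < Λ → Λ < t → two * Λ ≤ doubleUntil (fuel Λ t) Λ t
  raise-≥two*Λ {Λ} {t} Λ>0 Λ<t rewrite ℕP.+-comm ℤ.∣ Q.ceiling (t ÷₀ Λ) ∣ 1 with does (t ≤? Λ) in t≤?Λ
  ... | true = ⊥-elim (QP.<-irrefl refl (QP.<-≤-trans Λ<t (does-true (t ≤? Λ) t≤?Λ)))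
  ... | false = doubleUntil-≥start ℤ.∣ Q.ceiling (t ÷₀ Λ) ∣ t (*-pos two-pos Λ>0)

  raise-≤two*t : ∀ {Λ t} → 0ℚ < Λ → Λ < t → doubleUntil (fuel Λ t) Λ t ≤ two * t
  raise-≤two*t {Λ} {t} Λ>0 Λ<t = doubleUntil-≤two*t (fuel Λ t) t Λ>0
    (QP.<⇒≤ (QP.<-trans Λ<t (p<two*p (QP.<-trans Λ>0 Λ<t))))

anyL-map-true : ∀ (f : ℕ → Bool) {x} xs → x ∈ xs → f x ≡ true → anyL (map f xs) ≡ true
anyL-map-true f (y ∷ xs) (here refl) fx rewrite fx = refl
anyL-map-true f (y ∷ xs) (there x∈xs) fx rewrite anyL-map-true f xs x∈xs fx = BoolP.∨-zeroʳ (f y)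

module Levels {m'} (e : Fin (suc m') → ℤ) (e≤e₀ : ∀ i → e i ℤ.≤ e zero) where

  open LBPA e
  open Thresholds e using (1≤K)

  r≡pow2 : ∀ k → r k ≡ pow2 (e zero ℤ.- ℤ.+ (k ℕ.∸ 1))
  r≡pow2 k = sym (÷₀-unique (s̄ zero) (fromℕ-2^-pos (k ℕ.∸ 1))
    (trans (sym (pow2-+ (e zero ℤ.- c) (k ℕ.∸ 1))) (cong pow2 (i-j+j≡i (e zero) c))))
    where
    c = ℤ.+ (k ℕ.∸ 1)
    i-j+j≡i : ∀ i j → i ℤ.- j ℤ.+ j ≡ i
    i-j+j≡i = ℤRing.solve-∀

  r-pos : ∀ k → 0ℚ < r k
  r-pos k = subst (0ℚ <_) (sym (r≡pow2 k)) (pow2-pos (e zero ℤ.- ℤ.+ (k ℕ.∸ 1)))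

  r-nonNeg : ∀ k → 0ℚ ≤ r k
  r-nonNeg k = QP.<⇒≤ (r-pos k)

  r[1]≡s̄₀ : r 1 ≡ s̄ zero
  r[1]≡s̄₀ = trans (r≡pow2 1) (cong pow2 (ℤP.+-identityʳ (e zero)))

  two*r[2+k]≡r[1+k] : ∀ k → two * r (suc (suc k)) ≡ r (suc k)
  two*r[2+k]≡r[1+k] k = begin
    two * r (suc (suc k))                             ≡⟨ cong (two *_) (r≡pow2 (suc (suc k))) ⟩
    two * pow2 (e zero ℤ.- ℤ.+ suc k)                 ≡⟨ sym (pow2-suc (e zero ℤ.- ℤ.+ suc k)) ⟩
    pow2 (e zero ℤ.- (ℤ.+ 1 ℤ.+ ℤ.+ k) ℤ.+ ℤ.+ 1)     ≡⟨ cong pow2 (i-[1+j]+1≡i-j (e zero) (ℤ.+ k)) ⟩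
    pow2 (e zero ℤ.- ℤ.+ k)                           ≡⟨ sym (r≡pow2 (suc k)) ⟩
    r (suc k)                                         ∎
    where
    open ≡-Reasoning
    i-[1+j]+1≡i-j : ∀ i j → i ℤ.- (ℤ.+ 1 ℤ.+ j) ℤ.+ ℤ.+ 1 ≡ i ℤ.- j
    i-[1+j]+1≡i-j = ℤRing.solve-∀

  r≤s̄₀ : ∀ k → r k ≤ s̄ zero
  r≤s̄₀ k = subst₂ _≤_ (sym (r≡pow2 k)) refl (pow2-mono-≤ (ℤP.i-j≤i (e zero) (ℤ.+ (k ℕ.∸ 1))))

  level : Fin M → ℕ
  level i = suc ℤ.∣ e zero ℤ.- e i ∣

  private
    +∣e₀-e∣≡e₀-e : ∀ i → ℤ.+ ℤ.∣ e zero ℤ.- e i ∣ ≡ e zero ℤ.- e i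
    +∣e₀-e∣≡e₀-e i = ℤP.0≤i⇒+∣i∣≡i (ℤP.i≤j⇒0≤j-i (e≤e₀ i))

  s̄≡r[level] : ∀ i → s̄ i ≡ r (level i)
  s̄≡r[level] i = sym (trans (r≡pow2 (level i)) (cong pow2 (begin
    e zero ℤ.- ℤ.+ ℤ.∣ e zero ℤ.- e i ∣   ≡⟨ cong (λ z → e zero ℤ.- z) (+∣e₀-e∣≡e₀-e i) ⟩
    e zero ℤ.- (e zero ℤ.- e i)           ≡⟨ i-[i-j]≡j (e zero) (e i) ⟩
    e i                                   ∎)))
    where
    open ≡-Reasoning
    i-[i-j]≡j : ∀ i j → i ℤ.- (i ℤ.- j) ≡ j
    i-[i-j]≡j = ℤRing.solve-∀

  level≤ : ∀ {k} i → 1 ℕ.≤ k → r k ≤ s̄ i → level i ℕ.≤ k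
  level≤ {k} i 1≤k rk≤s̄ = subst (level i ℕ.≤_) (ℕP.suc-pred k {{ℕ.>-nonZero 1≤k}})
    (ℕ.s≤s (ℤP.drop‿+≤+ (subst (ℤ._≤ c) (sym (+∣e₀-e∣≡e₀-e i)) e₀-e≤c)))
    where
    c = ℤ.+ (k ℕ.∸ 1)
    e₀-c≤e : e zero ℤ.- c ℤ.≤ e i
    e₀-c≤e = pow2-cancel-≤ (subst₂ _≤_ (r≡pow2 k) refl rk≤s̄)
    a-x+[x-b]≡a-b : ∀ a b x → a ℤ.- x ℤ.+ (x ℤ.- b) ≡ a ℤ.- b
    a-x+[x-b]≡a-b = ℤRing.solve-∀
    b+[x-b]≡x : ∀ b x → b ℤ.+ (x ℤ.- b) ≡ x
    b+[x-b]≡x = ℤRing.solve-∀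
    e₀-e≤c : e zero ℤ.- e i ℤ.≤ c
    e₀-e≤c = subst₂ ℤ._≤_ (a-x+[x-b]≡a-b (e zero) (e i) c) (b+[x-b]≡x (e i) c)
      (ℤP.+-monoˡ-≤ (c ℤ.- e i) e₀-c≤e)

  inM≤-complete : ∀ {k} i → 1 ℕ.≤ k → k ℕ.≤ K → r k ≤ s̄ i → inM≤ k i ≡ true
  inM≤-complete {k} i 1≤k k≤K rk≤s̄ =
    anyL-map-true (λ k' → does (k' ℕ.≤? k) ∧ inM k' i) levels level∈levels
      (cong₂ _∧_ (dec-true (level i ℕ.≤? k) level≤k) (dec-true (s̄ i ≟ r (level i)) (s̄≡r[level] i)))
    where
    level≤k = level≤ i 1≤k rk≤s̄
    level∈levels : level i ∈ levels
    level∈levels = ∈-map⁺ suc (∈-upTo⁺ (ℕP.≤-trans level≤k k≤K))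

  s̄₀≤D : ∀ {k} → 1 ℕ.≤ k → k ℕ.≤ K → s̄ zero ≤ D k
  s̄₀≤D {k} 1≤k k≤K = subst (_≤ D k)
    (cong (λ b → if b then s̄ zero else 0ℚ) (inM≤-complete zero 1≤k k≤K (r≤s̄₀ k)))
    (f≤Σf (λ t → if-bool (0ℚ ≤_) (inM≤ k t) (λ _ → QP.<⇒≤ (pow2-pos (e t))) (λ _ → QP.≤-refl)) zero)

  D-pos : ∀ {k} → 1 ℕ.≤ k → k ℕ.≤ K → 0ℚ < D k
  D-pos 1≤k k≤K = QP.<-≤-trans (pow2-pos (e zero)) (s̄₀≤D 1≤k k≤K)

  M*r[K]≤two*s̄₀ : fromℕ M * r K ≤ two * s̄ zero
  M*r[K]≤two*s̄₀ = begin
    fromℕ M * r K                        ≤⟨ *-monoʳ-≤ (r K) (r-nonNeg K) (fromℕ-mono-≤ (ℕP.<⇒≤ (n<2^[⌊log2⌋n+1] M _))) ⟩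
    fromℕ (2 ^ K) * r K                  ≡⟨ cong (λ k → fromℕ (2 ^ k) * r K) (sym (ℕP.suc-pred K {{ℕ.>-nonZero 1≤K}})) ⟩
    fromℕ (2 ^ suc (K ℕ.∸ 1)) * r K     ≡⟨ cong (_* r K) (fromℕ-2^suc (K ℕ.∸ 1)) ⟩
    two * fromℕ (2 ^ (K ℕ.∸ 1)) * r K   ≡⟨ solve 3 (λ t n x → t :* n :* x := t :* (x :* n)) refl two _ (r K) ⟩
    two * (r K * fromℕ (2 ^ (K ℕ.∸ 1))) ≡⟨ cong (two *_) (÷₀-*-cancel (s̄ zero) (fromℕ-2^-pos (K ℕ.∸ 1))) ⟩
    two * s̄ zero                         ∎
    where open QP.≤-Reasoning

-- The charging argument

four six eight : ℚ
four = two * two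
six = two + four
eight = two * four

-- With R₁ ≤ 2 K Λ + Σ_{k<K} C_{1,k} and each C_{1,k} ≤ Λ, the charge w of the job causing a
-- reset is absorbed once Λ at least doubles (κ = K - 1).
potential-reset : ∀ {κ Λ Λ' w} → 0ℚ ≤ κ → 0ℚ ≤ Λ → two * Λ ≤ Λ' → w ≤ Λ' →
                  two * (κ + 1ℚ) * Λ + κ * Λ + w ≤ two * (κ + 1ℚ) * Λ'
potential-reset {κ} {Λ} {Λ'} {w} κ≥0 Λ≥0 2Λ≤Λ' w≤Λ' = begin
  two * n * Λ + κ * Λ + w     ≡⟨ cong (λ z → z + κ * Λ + w) (solve 3 (λ t l a → t :* l :* a := l :* (t :* a)) refl two n Λ) ⟩
  n * (two * Λ) + κ * Λ + w   ≤⟨ QP.+-mono-≤ (QP.+-mono-≤ (*-monoˡ-≤ n n≥0 2Λ≤Λ') (*-monoˡ-≤ κ κ≥0 Λ≤Λ')) w≤Λ' ⟩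
  n * Λ' + κ * Λ' + Λ'        ≡⟨ solve 2 (λ l a → (l :+ con 1ℚ) :* a :+ l :* a :+ a := con two :* (l :+ con 1ℚ) :* a) refl κ Λ' ⟩
  two * n * Λ'                ∎
  where
  open QP.≤-Reasoning
  n = κ + 1ℚ
  n≥0 : 0ℚ ≤ n
  n≥0 = +-nonNeg κ≥0 (QP.<⇒≤ (QP.positive⁻¹ 1ℚ))
  Λ≤Λ' : Λ ≤ Λ'
  Λ≤Λ' = QP.≤-trans (p≤two*p Λ≥0) 2Λ≤Λ'

module Analysis {m'} (s : Fin (suc m') → ℚ) (e : Fin (suc m') → ℤ)
  (s-antitone : ∀ i j → i Fin.≤ j → s j ≤ s i)
  (s-bracket : ∀ i → (pow2 (e i) ≤ s i) × (s i < pow2 (e i ℤ.+ ℤ.+ 1))) where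

  open LBPA e

  s̄≤s : ∀ i → s̄ i ≤ s i
  s̄≤s i = proj₁ (s-bracket i)

  s-pos : ∀ i → 0ℚ < s i
  s-pos i = QP.<-≤-trans (pow2-pos (e i)) (s̄≤s i)

  s<two*s̄ : ∀ i → s i < two * s̄ i
  s<two*s̄ i = subst (s i <_) (pow2-suc (e i)) (proj₂ (s-bracket i))

  s≤s₀ : ∀ i → s i ≤ s zero
  s≤s₀ i = s-antitone zero i ℕ.z≤n

  e≤e₀ : ∀ i → e i ℤ.≤ e zero
  e≤e₀ i with e i ℤP.≤? e zero
  ... | yes e≤ = e≤
  ... | no e≰ = ⊥-elim (QP.<-irrefl refl (QP.≤-<-trans
    (QP.≤-trans (pow2-mono-≤ (subst (ℤ._≤ e i) (ℤP.+-comm (ℤ.+ 1) (e zero)) (ℤP.i<j⇒suc[i]≤j (ℤP.≰⇒> e≰))))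
      (QP.≤-trans (s̄≤s i) (s≤s₀ i)))
    (proj₂ (s-bracket zero))))

  open Levels e e≤e₀
  open Thresholds e

  private
    inM≤-term-nonNeg : ∀ k t → 0ℚ ≤ (if inM≤ k t then s̄ t else 0ℚ)
    inM≤-term-nonNeg k t = if-bool (0ℚ ≤_) (inM≤ k t) (λ _ → QP.<⇒≤ (pow2-pos (e t))) (λ _ → QP.≤-refl)

  -- Once Λ > 4T, a machine able to finish a job larger than r (k+1) Λ within time T has s̄ ≥ r k.
  capacity-above-level : ∀ {T Λ k} → 0ℚ ≤ T → 1 ℕ.≤ k → k ℕ.≤ K → four * T < Λ →
                         capacity s T (r (suc k) * Λ) ≤ two * D k
  capacity-above-level {T} {Λ} {suc k} T≥0 1≤k k≤K 4T<Λ =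
    subst (capacity s T (r (suc (suc k)) * Λ) ≤_) (Σ-*ˡ two (λ t → if inM≤ (suc k) t then s̄ t else 0ℚ))
      (Σ-mono-≤ λ i → if-dec (_≤ two * (if inM≤ (suc k) i then s̄ i else 0ℚ)) (r (suc (suc k)) * Λ <? s i * T)
        (λ above → subst (λ b → s i ≤ two * (if b then s̄ i else 0ℚ))
           (sym (inM≤-complete i 1≤k k≤K (r[1+k]≤s̄ i above))) (QP.<⇒≤ (s<two*s̄ i)))
        (λ _ → *-nonNeg two-nonNeg (inM≤-term-nonNeg (suc k) i)))
    where
    r[1+k]≤s̄ : ∀ i → r (suc (suc k)) * Λ < s i * T → r (suc k) ≤ s̄ i
    r[1+k]≤s̄ i above = QP.<⇒≤ (*-cancelˡ-< two two-nonNeg (QP.<-trans two*r<s (s<two*s̄ i)))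
      where
      r*4*T<s*T : r (suc (suc k)) * four * T < s i * T
      r*4*T<s*T = QP.≤-<-trans (QP.≤-reflexive (QP.*-assoc (r (suc (suc k))) four T))
        (QP.<-trans (*-monoˡ-< (r (suc (suc k))) (r-pos (suc (suc k))) 4T<Λ) above)
      two*r<s : two * r (suc k) < s i
      two*r<s = subst (_< s i)
        (trans (solve 2 (λ x t → x :* (t :* t) := t :* (t :* x)) refl (r (suc (suc k))) two)
               (cong (two *_) (two*r[2+k]≡r[1+k] k)))
        (*-cancelʳ-< T T≥0 r*4*T<s*T)

  -- Machines outside M_{≤K} are slower than 2 r_K, and there are fewer than 2^K of them.
  Σs≤six*D[K] : Σ s ≤ six * D K
  Σs≤six*D[K] = begin
    Σ s                                          ≤⟨ Σ-mono-≤ s≤ ⟩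
    Σ (λ i → two * term i + two * r K)           ≡⟨ Σ-+ (λ i → two * term i) (λ _ → two * r K) ⟩
    Σ (λ i → two * term i) + Σ {M} (λ _ → two * r K)
                                                 ≡⟨ cong₂ _+_ (Σ-*ˡ two term) (Σ-const M (two * r K)) ⟩
    two * D K + fromℕ M * (two * r K)            ≡⟨ cong (two * D K +_) (solve 3 (λ m t x → m :* (t :* x) := t :* (m :* x)) refl (fromℕ M) two (r K)) ⟩
    two * D K + two * (fromℕ M * r K)            ≤⟨ QP.+-monoʳ-≤ (two * D K) (*-monoˡ-≤ two two-nonNeg
                                                      (QP.≤-trans M*r[K]≤two*s̄₀ (*-monoˡ-≤ two two-nonNeg (s̄₀≤D 1≤K ℕP.≤-refl)))) ⟩
    two * D K + two * (two * D K)                ≡⟨ solve 2 (λ t d → t :* d :+ t :* (t :* d) := (t :+ t :* t) :* d) refl two (D K) ⟩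
    six * D K                                    ∎
    where
    open QP.≤-Reasoning
    term : Fin M → ℚ
    term i = if inM≤ K i then s̄ i else 0ℚ
    s≤ : ∀ i → s i ≤ two * term i + two * r K
    s≤ i = if-bool (λ x → s i ≤ two * x + two * r K) (inM≤ K i)
      (λ _ → QP.≤-trans (QP.<⇒≤ (s<two*s̄ i)) (p≤p+q (two * r K) (*-nonNeg two-nonNeg (r-nonNeg K))))
      (λ i∉ → QP.≤-trans (QP.<⇒≤ (QP.<-trans (s<two*s̄ i) (*-monoˡ-< two two-pos (QP.≰⇒> (s̄≱r[K] i∉)))))
                (p≤q+p (two * 0ℚ) (QP.≤-reflexive (sym (QP.*-zeroʳ two)))))
      where
      s̄≱r[K] : inM≤ K i ≡ false → ¬ (r K ≤ s̄ i)
      s̄≱r[K] i∉ rK≤s̄ = true≢false (trans (sym (inM≤-complete i 1≤K ℕP.≤-refl rK≤s̄)) i∉)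

  module Run (T : ℚ) (T≥0 : 0ℚ ≤ T) where

    open State using (Λ; C)

    κ : ℚ
    κ = fromℕ ⌊log₂ M ⌋

    κ≥0 : 0ℚ ≤ κ
    κ≥0 = fromℕ-nonNeg ⌊log₂ M ⌋

    K≡κ+1 : fromℕ K ≡ κ + 1ℚ
    K≡κ+1 = fromℕ-+ ⌊log₂ M ⌋ 1

    -- heavy≤makespan*capacity, split between the jobs already scheduled and those still to come
    VolumeBound : List ℚ → List ℚ → Set
    VolumeBound done rest = ∀ θ → heavy done θ + heavy rest θ ≤ T * capacity s T θ

    VolumeBound-shift : ∀ {done p rest} → VolumeBound done (p ∷ rest) → VolumeBound (p ∷ done) rest
    VolumeBound-shift {done} {p} {rest} V θ = subst (_≤ T * capacity s T θ)
      (solve 3 (λ a b c → b :+ (a :+ c) := (a :+ b) :+ c) refl (large θ p) (heavy done θ) (heavy rest θ)) (V θ)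

    job≤s₀*T : ∀ {done p rest} → 0ℚ < p → All (0ℚ ≤_) done → All (0ℚ ≤_) rest →
               VolumeBound done (p ∷ rest) → p ≤ s zero * T
    job≤s₀*T {done} {p} {rest} p>0 done≥0 rest≥0 V = QP.≮⇒≥ λ θ<p → QP.<-irrefl refl
      (QP.<-≤-trans p>0 (QP.≤-trans (p≤volume θ<p) (QP.≤-trans (V θ) no-capacity)))
      where
      θ = s zero * T
      p≤volume : θ < p → p ≤ heavy done θ + heavy (p ∷ rest) θ
      p≤volume θ<p = QP.≤-trans (QP.≤-reflexive (sym (large-> θ<p)))
        (QP.≤-trans (p≤p+q (heavy rest θ) (heavy-nonNeg θ rest≥0)) (p≤q+p (heavy done θ) (heavy-nonNeg θ done≥0)))
      no-capacity : T * capacity s T θ ≤ 0ℚ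
      no-capacity = subst (T * capacity s T θ ≤_) (QP.*-zeroʳ T) (*-monoˡ-≤ T T≥0
        (subst (capacity s T θ ≤_) (Σ-zero M) (Σ-mono-≤ {f = λ i → if does (θ <? s i * T) then s i else 0ℚ} {λ _ → 0ℚ} λ i → if-dec (_≤ 0ℚ) (θ <? s i * T)
          (λ θ< → ⊥-elim (QP.<-irrefl refl (QP.<-≤-trans θ< (*-monoʳ-≤ T T≥0 (s≤s₀ i)))))
          (λ _ → QP.≤-refl))))

    -- R₁ and R₂ are the counter increments at machine 1 caused so far by jobs
    -- of level below K and of level K respectively.
    record Invariant (σ : State) (done : List ℚ) (R₁ R₂ : ℚ) : Set where
      field
        Λ-pos : 0ℚ < Λ σ
        Λ≤8T : Λ σ ≤ eight * T
        counter≤Λ : ∀ {k} → k ∈ lowerLevels → C σ zero k ≤ Λ σ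
        counter*D≤heavy : ∀ {k} → k ∈ lowerLevels → C σ zero k * D k ≤ heavy done (r (suc k) * Λ σ)
        R₁≤ : R₁ ≤ two * fromℕ K * Λ σ + sumOver lowerLevels (C σ zero)
        R₂*D≤heavy : R₂ * D K ≤ heavy done 0ℚ

    runLoad : Fin M → State → List ℚ → ℚ
    runLoad i σ rest = foldr _+_ 0ℚ (zipWith (λ x p → (x i * p) ÷₀ s i) (runRest σ rest) rest)

    bound : ℚ
    bound = (two + 1ℚ) * fromℕ K * (eight * T) + six * T

    t≤two*T : ∀ {p} → p ≤ s zero * T → p ÷₀ r 1 ≤ two * T
    t≤two*T {p} p≤s₀T = ÷₀-≤ p (r-pos 1) (QP.≤-trans p≤s₀T (QP.≤-trans (*-monoʳ-≤ T T≥0 (QP.<⇒≤ (s<two*s̄ zero)))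
      (QP.≤-reflexive (trans (solve 3 (λ a b c → a :* b :* c := a :* c :* b) refl two (s̄ zero) T)
                             (cong (two * T *_) (sym r[1]≡s̄₀))))))

    four*T≤eight*T : four * T ≤ eight * T
    four*T≤eight*T = QP.≤-trans (p≤two*p (*-nonNeg (*-nonNeg two-nonNeg two-nonNeg) T≥0))
      (QP.≤-reflexive (sym (QP.*-assoc two four T)))

    two*T≤eight*T : two * T ≤ eight * T
    two*T≤eight*T = QP.≤-trans (QP.≤-trans (p≤two*p (*-nonNeg two-nonNeg T≥0))
      (QP.≤-reflexive (sym (QP.*-assoc two two T)))) four*T≤eight*T

    module Step {σ : State} {done : List ℚ} {R₁ R₂ p : ℚ} {rest : List ℚ}
                (p>0 : 0ℚ < p) (done≥0 : All (0ℚ ≤_) done) (rest≥0 : All (0ℚ ≤_) rest)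
                (V : VolumeBound done (p ∷ rest)) (I : Invariant σ done R₁ R₂) where

      open Invariant I

      k : ℕ
      k = kOf (Λ σ) p

      1≤k : 1 ℕ.≤ k
      1≤k = kOf-≥1 (Λ σ) p

      k≤K : k ℕ.≤ K
      k≤K = kOf-≤K (Λ σ) p

      D[k]>0 : 0ℚ < D k
      D[k]>0 = D-pos 1≤k k≤K

      -- every machine of M_{≤k} receives the same amount w of work per unit of s̄
      w : ℚ
      w = p ÷₀ D k

      w≥0 : 0ℚ ≤ w
      w≥0 = ÷₀-nonNeg (QP.<⇒≤ p>0) D[k]>0

      w*D≡p : w * D k ≡ p
      w*D≡p = ÷₀-*-cancel p D[k]>0

      x : Fin M → ℚ
      x = colOf σ p

      share≤w : ∀ i → (x i * p) ÷₀ s i ≤ w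
      share≤w i = if-bool (λ z → (z * p) ÷₀ s i ≤ w) (inM≤ k i)
        (λ _ → ÷₀-≤ _ (s-pos i) (QP.≤-trans (QP.≤-reflexive x*p≡s̄*w)
                 (subst (s̄ i * w ≤_) (QP.*-comm (s i) w) (*-monoʳ-≤ w w≥0 (s̄≤s i)))))
        (λ _ → ÷₀-≤ _ (s-pos i) (subst (_≤ w * s i) (sym (QP.*-zeroˡ p)) (*-nonNeg w≥0 (QP.<⇒≤ (s-pos i)))))
        where
        x*p≡s̄*w : (s̄ i ÷₀ D k) * p ≡ s̄ i * w
        x*p≡s̄*w = *-cancelʳ-≡ (D k) D[k]>0 (begin
          (s̄ i ÷₀ D k) * p * D k   ≡⟨ solve 3 (λ a b c → a :* b :* c := a :* c :* b) refl (s̄ i ÷₀ D k) p (D k) ⟩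
          (s̄ i ÷₀ D k) * D k * p   ≡⟨ cong (_* p) (÷₀-*-cancel (s̄ i) D[k]>0) ⟩
          s̄ i * p                  ≡⟨ cong (s̄ i *_) (sym w*D≡p) ⟩
          s̄ i * (w * D k)          ≡⟨ sym (QP.*-assoc (s̄ i) w (D k)) ⟩
          s̄ i * w * D k            ∎)
          where open ≡-Reasoning

      share₀≡w : (x zero * p) ÷₀ s̄ zero ≡ w
      share₀≡w = trans (cong (λ b → ((if b then s̄ zero ÷₀ D k else 0ℚ) * p) ÷₀ s̄ zero) (inM≤-complete zero 1≤k k≤K (r≤s̄₀ k)))
        (sym (÷₀-unique ((s̄ zero ÷₀ D k) * p) (pow2-pos (e zero)) (begin
          w * s̄ zero                      ≡⟨ cong (w *_) (sym (÷₀-*-cancel (s̄ zero) D[k]>0)) ⟩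
          w * ((s̄ zero ÷₀ D k) * D k)     ≡⟨ solve 3 (λ w v d → w :* (v :* d) := v :* (w :* d)) refl w (s̄ zero ÷₀ D k) (D k) ⟩
          (s̄ zero ÷₀ D k) * (w * D k)     ≡⟨ cong ((s̄ zero ÷₀ D k) *_) w*D≡p ⟩
          (s̄ zero ÷₀ D k) * p             ∎)))
        where open ≡-Reasoning

      C' : Fin M → ℕ → ℚ
      C' i k' = if does (k' ℕ.≟ k) then C σ i k + ((x i * p) ÷₀ s̄ i) else C σ i k'

      C'-at-k : C' zero k ≡ C σ zero k + w
      C'-at-k = trans (cong (λ b → if b then C σ zero k + (x zero * p) ÷₀ s̄ zero else C σ zero k) (dec-true (k ℕ.≟ k) refl))
                      (cong (C σ zero k +_) share₀≡w)

      C'-elsewhere : ∀ {k'} → k' ≢ k → C' zero k' ≡ C σ zero k'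
      C'-elsewhere {k'} k'≢k = cong (λ b → if b then C σ zero k + (x zero * p) ÷₀ s̄ zero else C σ zero k') (dec-false (k' ℕ.≟ k) k'≢k)

      C≤C' : ∀ k' → C σ zero k' ≤ C' zero k'
      C≤C' k' = if-dec (C σ zero k' ≤_) (k' ℕ.≟ k)
        (λ { refl → p≤p+q _ (subst (0ℚ ≤_) (sym share₀≡w) w≥0) })
        (λ _ → QP.≤-refl)

      heavy-grows : ∀ θ → heavy done θ ≤ heavy (p ∷ done) θ
      heavy-grows θ = p≤q+p (large θ p) (large-nonNeg θ (QP.<⇒≤ p>0))

      heavy≤T*capacity : ∀ θ → heavy (p ∷ done) θ ≤ T * capacity s T θ
      heavy≤T*capacity θ = QP.≤-trans (p≤p+q (heavy rest θ) (heavy-nonNeg θ rest≥0))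
        (VolumeBound-shift {done} {p} {rest} V θ)

      p≤s₀T : p ≤ s zero * T
      p≤s₀T = job≤s₀*T p>0 done≥0 rest≥0 V

      t : ℚ
      t = p ÷₀ r 1

      w≤t : w ≤ t
      w≤t = ÷₀-antiʳ-≤ (QP.<⇒≤ p>0) (r-pos 1) (subst (_≤ D k) (sym r[1]≡s̄₀) (s̄₀≤D 1≤k k≤K))

      C'*D≤heavy : k ℕ.< K → C' zero k * D k ≤ heavy (p ∷ done) (r (suc k) * Λ σ)
      C'*D≤heavy k<K = begin
        C' zero k * D k               ≡⟨ cong (_* D k) C'-at-k ⟩
        (C σ zero k + w) * D k        ≡⟨ QP.*-distribʳ-+ (D k) (C σ zero k) w ⟩
        C σ zero k * D k + w * D k    ≡⟨ cong (C σ zero k * D k +_) w*D≡p ⟩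
        C σ zero k * D k + p          ≤⟨ QP.+-monoˡ-≤ p (counter*D≤heavy (<K⇒∈lowerLevels 1≤k k<K)) ⟩
        heavy done θ + p              ≡⟨ QP.+-comm (heavy done θ) p ⟩
        p + heavy done θ              ≡⟨ cong (_+ heavy done θ) (sym (large-> (kOf-maximal (Λ σ) p k<K))) ⟩
        heavy (p ∷ done) θ            ∎
        where
        open QP.≤-Reasoning
        θ = r (suc k) * Λ σ

      -- An overflow needs more than Λ · D k volume of jobs above r (k+1) Λ; for Λ > 4T the
      -- optimum can fit at most T · 2 D k of it.
      overflow⇒Λ≤4T : k ℕ.< K → Λ σ < C' zero k → Λ σ ≤ four * T
      overflow⇒Λ≤4T k<K overflow = QP.≮⇒≥ λ 4T<Λ → QP.<-irrefl refl (QP.<-trans 4T<Λ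
        (QP.<-≤-trans (Λ<two*T 4T<Λ) (QP.≤-trans (p≤two*p (*-nonNeg two-nonNeg T≥0))
          (QP.≤-reflexive (solve 2 (λ t x → t :* (t :* x) := t :* t :* x) refl two T)))))
        where
        θ = r (suc k) * Λ σ
        Λ<two*T : four * T < Λ σ → Λ σ < two * T
        Λ<two*T 4T<Λ = *-cancelʳ-< (D k) (QP.<⇒≤ D[k]>0) (begin-strict
          Λ σ * D k                 <⟨ *-monoʳ-< (D k) D[k]>0 overflow ⟩
          C' zero k * D k           ≤⟨ C'*D≤heavy k<K ⟩
          heavy (p ∷ done) θ        ≤⟨ heavy≤T*capacity θ ⟩
          T * capacity s T θ        ≤⟨ *-monoˡ-≤ T T≥0 (capacity-above-level {T} {Λ σ} {k} T≥0 1≤k k≤K 4T<Λ) ⟩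
          T * (two * D k)           ≡⟨ solve 3 (λ a b c → a :* (b :* c) := b :* a :* c) refl T two (D k) ⟩
          two * T * D k             ∎)
          where open QP.≤-Reasoning

      StepResult : State → Set
      StepResult σ' = ∃ λ R₁' → ∃ λ R₂' → (R₁ + R₂ + w ≤ R₁' + R₂') × Invariant σ' (p ∷ done) R₁' R₂'

      private
        R₁+R₂+w≡R₁+w+R₂ : R₁ + R₂ + w ≡ R₁ + w + R₂
        R₁+R₂+w≡R₁+w+R₂ = solve 3 (λ a b c → a :+ b :+ c := a :+ c :+ b) refl R₁ R₂ w

        unchanged-counter*D≤heavy : ∀ {k'} → k' ∈ lowerLevels → k' ≢ k →
                                    C' zero k' * D k' ≤ heavy (p ∷ done) (r (suc k') * Λ σ)
        unchanged-counter*D≤heavy {k'} k'∈ k'≢k = subst (λ c → c * D k' ≤ heavy (p ∷ done) (r (suc k') * Λ σ))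
          (sym (C'-elsewhere k'≢k)) (QP.≤-trans (counter*D≤heavy k'∈) (heavy-grows (r (suc k') * Λ σ)))

      reset : ∀ {Λ'} → two * Λ σ ≤ Λ' → Λ' ≤ eight * T → w ≤ Λ' → StepResult (st Λ' zeroC)
      reset {Λ'} 2Λ≤Λ' Λ'≤8T w≤Λ' = R₁ + w , R₂ , QP.≤-reflexive R₁+R₂+w≡R₁+w+R₂ , record
        { Λ-pos = Λ'>0
        ; Λ≤8T = Λ'≤8T
        ; counter≤Λ = λ _ → QP.<⇒≤ Λ'>0
        ; counter*D≤heavy = λ {k'} _ → subst (_≤ heavy (p ∷ done) (r (suc k') * Λ')) (sym (QP.*-zeroˡ (D k')))
            (heavy-nonNeg (r (suc k') * Λ') (QP.<⇒≤ p>0 ∷ done≥0))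
        ; R₁≤ = begin
            R₁ + w                                                     ≤⟨ QP.+-monoˡ-≤ w R₁≤ ⟩
            two * fromℕ K * Λ σ + sumOver lowerLevels (C σ zero) + w   ≤⟨ QP.+-monoˡ-≤ w (QP.+-monoʳ-≤ (two * fromℕ K * Λ σ) counters≤κΛ) ⟩
            two * fromℕ K * Λ σ + κ * Λ σ + w                          ≡⟨ cong (λ n → two * n * Λ σ + κ * Λ σ + w) K≡κ+1 ⟩
            two * (κ + 1ℚ) * Λ σ + κ * Λ σ + w                         ≤⟨ potential-reset κ≥0 (QP.<⇒≤ Λ-pos) 2Λ≤Λ' w≤Λ' ⟩
            two * (κ + 1ℚ) * Λ'                                        ≡⟨ cong (λ n → two * n * Λ') (sym K≡κ+1) ⟩
            two * fromℕ K * Λ'                                         ≡⟨ sym (QP.+-identityʳ _) ⟩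
            two * fromℕ K * Λ' + 0ℚ                                    ≡⟨ cong (two * fromℕ K * Λ' +_) (sym (sumOver-zero lowerLevels)) ⟩
            two * fromℕ K * Λ' + sumOver lowerLevels (λ _ → 0ℚ)        ∎
        ; R₂*D≤heavy = QP.≤-trans R₂*D≤heavy (heavy-grows 0ℚ)
        }
        where
        open QP.≤-Reasoning
        Λ'>0 : 0ℚ < Λ'
        Λ'>0 = QP.<-≤-trans (*-pos two-pos Λ-pos) 2Λ≤Λ'
        counters≤κΛ : sumOver lowerLevels (C σ zero) ≤ κ * Λ σ
        counters≤κΛ = subst (λ n → sumOver lowerLevels (C σ zero) ≤ fromℕ n * Λ σ) length-lowerLevels
          (sumOver-≤ lowerLevels counter≤Λ)

      raised : k ℕ.< K → Λ σ < t → StepResult (st (doubleUntil (fuel (Λ σ) t) (Λ σ) t) zeroC)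
      raised k<K Λ<t = reset (raise-≥two*Λ Λ-pos Λ<t)
        (QP.≤-trans (raise-≤two*t Λ-pos Λ<t) (QP.≤-trans (*-monoˡ-≤ two two-nonNeg (t≤two*T p≤s₀T))
          (QP.≤-trans (QP.≤-reflexive (sym (QP.*-assoc two two T))) four*T≤eight*T)))
        (QP.≤-trans w≤t (raise-≥ t Λ-pos))

      doubled : k ℕ.< K → ¬ (Λ σ < t) → Λ σ < C' zero k → StepResult (st (two * Λ σ) zeroC)
      doubled k<K Λ≮t overflow = reset QP.≤-refl
        (QP.≤-trans (*-monoˡ-≤ two two-nonNeg (overflow⇒Λ≤4T k<K overflow)) (QP.≤-reflexive (sym (QP.*-assoc two four T))))
        (QP.≤-trans w≤t (QP.≤-trans (QP.≮⇒≥ Λ≮t) (p≤two*p (QP.<⇒≤ Λ-pos))))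

      accumulated : k ℕ.< K → ¬ (Λ σ < t) → ¬ (Λ σ < C' zero k) → StepResult (st (Λ σ) C')
      accumulated k<K Λ≮t no-overflow = R₁ + w , R₂ , QP.≤-reflexive R₁+R₂+w≡R₁+w+R₂ , record
        { Λ-pos = Λ-pos
        ; Λ≤8T = Λ≤8T
        ; counter≤Λ = λ {k'} k'∈ → counter≤Λ' k'∈ (k' ℕ.≟ k)
        ; counter*D≤heavy = λ {k'} k'∈ → counter*D≤heavy' k'∈ (k' ℕ.≟ k)
        ; R₁≤ = QP.≤-trans (QP.+-monoˡ-≤ w R₁≤)
            (QP.≤-trans (QP.≤-reflexive (QP.+-assoc (two * fromℕ K * Λ σ) (sumOver lowerLevels (C σ zero)) w))
              (QP.+-monoʳ-≤ (two * fromℕ K * Λ σ)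
                (sumOver-bump lowerLevels (<K⇒∈lowerLevels 1≤k k<K) C≤C' (QP.≤-reflexive (sym C'-at-k)))))
        ; R₂*D≤heavy = QP.≤-trans R₂*D≤heavy (heavy-grows 0ℚ)
        }
        where
        counter≤Λ' : ∀ {k'} → k' ∈ lowerLevels → Dec (k' ≡ k) → C' zero k' ≤ Λ σ
        counter≤Λ' _ (yes refl) = QP.≮⇒≥ no-overflow
        counter≤Λ' k'∈ (no k'≢k) = subst (_≤ Λ σ) (sym (C'-elsewhere k'≢k)) (counter≤Λ k'∈)
        counter*D≤heavy' : ∀ {k'} → k' ∈ lowerLevels → Dec (k' ≡ k) →
                           C' zero k' * D k' ≤ heavy (p ∷ done) (r (suc k') * Λ σ)
        counter*D≤heavy' _ (yes refl) = C'*D≤heavy k<K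
        counter*D≤heavy' k'∈ (no k'≢k) = unchanged-counter*D≤heavy k'∈ k'≢k

      top : ¬ (k ℕ.< K) → StepResult (st (Λ σ) C')
      top k≮K = R₁ , R₂ + w , QP.≤-reflexive (QP.+-assoc R₁ R₂ w) , record
        { Λ-pos = Λ-pos
        ; Λ≤8T = Λ≤8T
        ; counter≤Λ = λ k'∈ → subst (_≤ Λ σ) (sym (C'-elsewhere (below-k k'∈))) (counter≤Λ k'∈)
        ; counter*D≤heavy = λ k'∈ → unchanged-counter*D≤heavy k'∈ (below-k k'∈)
        ; R₁≤ = QP.≤-trans R₁≤ (QP.+-monoʳ-≤ (two * fromℕ K * Λ σ) (sumOver-mono-≤ lowerLevels C≤C'))
        ; R₂*D≤heavy = begin
            (R₂ + w) * D K            ≡⟨ QP.*-distribʳ-+ (D K) R₂ w ⟩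
            R₂ * D K + w * D K        ≡⟨ cong (λ k → R₂ * D K + w * D k) (sym k≡K) ⟩
            R₂ * D K + w * D k        ≡⟨ cong (R₂ * D K +_) w*D≡p ⟩
            R₂ * D K + p              ≤⟨ QP.+-monoˡ-≤ p R₂*D≤heavy ⟩
            heavy done 0ℚ + p         ≡⟨ QP.+-comm (heavy done 0ℚ) p ⟩
            p + heavy done 0ℚ         ≡⟨ cong (_+ heavy done 0ℚ) (sym (large-> p>0)) ⟩
            heavy (p ∷ done) 0ℚ       ∎
        }
        where
        open QP.≤-Reasoning
        k≡K : k ≡ K
        k≡K = ℕP.≤-antisym k≤K (ℕP.≮⇒≥ k≮K)
        below-k : ∀ {k'} → k' ∈ lowerLevels → k' ≢ k
        below-k k'∈ refl = k≮K (∈lowerLevels⇒<K k'∈)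

      step : StepResult (stepState σ p)
      step = if-dec StepResult (k ℕ.<? K)
        (λ k<K → if-dec StepResult (Λ σ <? t) (raised k<K)
          (λ Λ≮t → if-dec StepResult (Λ σ <? C' zero k) (doubled k<K Λ≮t) (accumulated k<K Λ≮t)))
        top

    charges≤bound : ∀ {σ done R₁ R₂} → VolumeBound done [] → Invariant σ done R₁ R₂ → R₁ + R₂ ≤ bound
    charges≤bound {σ} {done} {R₁} {R₂} V I = QP.+-mono-≤ R₁-final R₂-final
      where
      open Invariant I
      open QP.≤-Reasoning
      R₁-final : R₁ ≤ (two + 1ℚ) * fromℕ K * (eight * T)
      R₁-final = begin
        R₁                                                       ≤⟨ R₁≤ ⟩
        two * fromℕ K * Λ σ + sumOver lowerLevels (C σ zero)     ≤⟨ QP.+-monoʳ-≤ (two * fromℕ K * Λ σ) (sumOver-≤ lowerLevels counter≤Λ) ⟩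
        two * fromℕ K * Λ σ + fromℕ (length lowerLevels) * Λ σ  ≤⟨ QP.+-monoʳ-≤ (two * fromℕ K * Λ σ) (*-monoʳ-≤ (Λ σ) (QP.<⇒≤ Λ-pos)
                                                                      (fromℕ-mono-≤ (ℕP.≤-trans (ℕP.≤-reflexive length-lowerLevels) (ℕP.m≤m+n ⌊log₂ M ⌋ 1)))) ⟩
        two * fromℕ K * Λ σ + fromℕ K * Λ σ                     ≡⟨ solve 3 (λ t n a → t :* n :* a :+ n :* a := (t :+ con 1ℚ) :* n :* a) refl two (fromℕ K) (Λ σ) ⟩
        (two + 1ℚ) * fromℕ K * Λ σ                               ≤⟨ *-monoˡ-≤ ((two + 1ℚ) * fromℕ K)
                                                                      (*-nonNeg (+-nonNeg two-nonNeg (QP.<⇒≤ (QP.positive⁻¹ 1ℚ))) (fromℕ-nonNeg K)) Λ≤8T ⟩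
        (two + 1ℚ) * fromℕ K * (eight * T)                       ∎
      R₂-final : R₂ ≤ six * T
      R₂-final = subst (R₂ ≤_) (QP.*-comm T six) (*-cancelʳ-≤ (D K) (D-pos 1≤K ℕP.≤-refl) (begin
        R₂ * D K                 ≤⟨ R₂*D≤heavy ⟩
        heavy done 0ℚ            ≡⟨ sym (QP.+-identityʳ (heavy done 0ℚ)) ⟩
        heavy done 0ℚ + 0ℚ       ≤⟨ V 0ℚ ⟩
        T * capacity s T 0ℚ      ≤⟨ *-monoˡ-≤ T T≥0 (Σ-mono-≤ λ i → if-dec (_≤ s i) (0ℚ <? s i * T) (λ _ → QP.≤-refl) (λ _ → QP.<⇒≤ (s-pos i))) ⟩
        T * Σ s                  ≤⟨ *-monoˡ-≤ T T≥0 Σs≤six*D[K] ⟩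
        T * (six * D K)          ≡⟨ sym (QP.*-assoc T six (D K)) ⟩
        T * six * D K            ∎))

    later-load-bound : ∀ rest {σ done R₁ R₂} → All (0ℚ <_) rest → All (0ℚ ≤_) done →
                       VolumeBound done rest → Invariant σ done R₁ R₂ →
                       ∀ i → R₁ + R₂ + runLoad i σ rest ≤ bound
    later-load-bound [] {R₁ = R₁} {R₂} _ _ V I i =
      QP.≤-trans (QP.≤-reflexive (QP.+-identityʳ (R₁ + R₂))) (charges≤bound V I)
    later-load-bound (p ∷ rest) {σ} {done} {R₁} {R₂} (p>0 ∷ rest>0) done≥0 V I i = from-step S.step
      where
      module S = Step p>0 done≥0 (All.map QP.<⇒≤ rest>0) V I
      open QP.≤-Reasoning
      share = (colOf σ p i * p) ÷₀ s i
      later = runLoad i (stepState σ p) rest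
      from-step : S.StepResult (stepState σ p) → R₁ + R₂ + (share + later) ≤ bound
      from-step (R₁' , R₂' , charged , I') = begin
        R₁ + R₂ + (share + later)   ≡⟨ sym (QP.+-assoc (R₁ + R₂) share later) ⟩
        R₁ + R₂ + share + later     ≤⟨ QP.+-monoˡ-≤ later (QP.+-monoʳ-≤ (R₁ + R₂) (S.share≤w i)) ⟩
        R₁ + R₂ + S.w + later       ≤⟨ QP.+-monoˡ-≤ later charged ⟩
        R₁' + R₂' + later           ≤⟨ later-load-bound rest rest>0 (QP.<⇒≤ p>0 ∷ done≥0) (VolumeBound-shift {done} {p} {rest} V) I' i ⟩
        bound                       ∎

    two*T+bound≤32K*T : two * T + bound ≤ fromℕ (32 ℕ.* K) * T
    two*T+bound≤32K*T = begin
      two * T + ((two + 1ℚ) * fromℕ K * (eight * T) + six * T)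
        ≡⟨ solve 2 (λ n x → con two :* x :+ ((con two :+ con 1ℚ) :* n :* (con eight :* x) :+ con six :* x)
                          := con (fromℕ 8) :* x :+ con (fromℕ 24) :* (n :* x)) refl (fromℕ K) T ⟩
      fromℕ 8 * T + fromℕ 24 * (fromℕ K * T)
        ≤⟨ QP.+-monoˡ-≤ (fromℕ 24 * (fromℕ K * T)) (*-monoˡ-≤ (fromℕ 8) (fromℕ-nonNeg 8) T≤K*T) ⟩
      fromℕ 8 * (fromℕ K * T) + fromℕ 24 * (fromℕ K * T)
        ≡⟨ solve 2 (λ n x → con (fromℕ 8) :* (n :* x) :+ con (fromℕ 24) :* (n :* x) := con (fromℕ 32) :* n :* x) refl (fromℕ K) T ⟩
      fromℕ 32 * fromℕ K * T
        ≡⟨ cong (_* T) (sym (fromℕ-* 32 K)) ⟩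
      fromℕ (32 ℕ.* K) * T ∎
      where
      open QP.≤-Reasoning
      T≤K*T : T ≤ fromℕ K * T
      T≤K*T = subst (_≤ fromℕ K * T) (QP.*-identityˡ T) (*-monoʳ-≤ T T≥0 (fromℕ-mono-≤ 1≤K))

  obj≤32K*makespan : ∀ {p₁ ps} → 0ℚ < p₁ → All (0ℚ <_) ps → (σ : Fin (length (p₁ ∷ ps)) → Fin M) →
                     obj s (allocate p₁ ps) (p₁ ∷ ps) ≤ fromℕ (32 ℕ.* K) * makespan s (p₁ ∷ ps) σ
  obj≤32K*makespan {p₁} {ps} p₁>0 ps>0 σ = Max-lub λ i →
    QP.≤-trans (QP.+-mono-≤ (first-share≤two*T i) (subst (_≤ bound) (QP.+-identityˡ (runLoad i (firstState p₁) ps))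
                 (later-load-bound ps ps>0 (QP.<⇒≤ p₁>0 ∷ []) V₁ I₁ i)))
               two*T+bound≤32K*T
    where
    jobs≥0 : All (0ℚ ≤_) (p₁ ∷ ps)
    jobs≥0 = All.map QP.<⇒≤ (p₁>0 ∷ ps>0)
    T = makespan s (p₁ ∷ ps) σ
    T≥0 : 0ℚ ≤ T
    T≥0 = makespan-nonNeg s s-pos jobs≥0 σ
    open Run T T≥0

    V₀ : VolumeBound [] (p₁ ∷ ps)
    V₀ θ = subst (_≤ T * capacity s T θ) (sym (QP.+-identityˡ _)) (heavy≤makespan*capacity s s-pos jobs≥0 σ θ)

    V₁ : VolumeBound (p₁ ∷ []) ps
    V₁ = VolumeBound-shift {[]} {p₁} {ps} V₀

    p₁≤s₀T : p₁ ≤ s zero * T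
    p₁≤s₀T = job≤s₀*T p₁>0 [] (All.map QP.<⇒≤ ps>0) V₀

    Λ₁>0 : 0ℚ < p₁ ÷₀ r 1
    Λ₁>0 = ÷₀-pos p₁>0 (r-pos 1)

    I₁ : Invariant (firstState p₁) (p₁ ∷ []) 0ℚ 0ℚ
    I₁ = record
      { Λ-pos = Λ₁>0
      ; Λ≤8T = QP.≤-trans (t≤two*T p₁≤s₀T) two*T≤eight*T
      ; counter≤Λ = λ _ → QP.<⇒≤ Λ₁>0
      ; counter*D≤heavy = λ {k} _ → subst (_≤ heavy (p₁ ∷ []) (r (suc k) * (p₁ ÷₀ r 1))) (sym (QP.*-zeroˡ (D k)))
          (heavy-nonNeg (r (suc k) * (p₁ ÷₀ r 1)) (QP.<⇒≤ p₁>0 ∷ []))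
      ; R₁≤ = +-nonNeg (*-nonNeg (*-nonNeg two-nonNeg (fromℕ-nonNeg K)) (QP.<⇒≤ Λ₁>0))
                       (QP.≤-reflexive (sym (sumOver-zero lowerLevels)))
      ; R₂*D≤heavy = subst (_≤ heavy (p₁ ∷ []) 0ℚ) (sym (QP.*-zeroˡ (D K))) (heavy-nonNeg 0ℚ (QP.<⇒≤ p₁>0 ∷ []))
      }

    first-share≤two*T : ∀ i → (firstCol i * p₁) ÷₀ s i ≤ two * T
    first-share≤two*T i = if-bool (λ z → (z * p₁) ÷₀ s i ≤ two * T) (inM 1 i)
      (λ i∈M₁ → ÷₀-≤ _ (s-pos i) (share≤ (does-true (s̄ i ≟ r 1) i∈M₁)))
      (λ _ → ÷₀-≤ _ (s-pos i) (subst (_≤ two * T * s i) (sym (QP.*-zeroˡ p₁))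
                                 (*-nonNeg (*-nonNeg two-nonNeg T≥0) (QP.<⇒≤ (s-pos i)))))
      where
      1≤|M₁| : 1ℚ ≤ count (inM 1)
      1≤|M₁| = subst (_≤ count (inM 1)) (cong (λ b → if b then 1ℚ else 0ℚ) (dec-true (s̄ zero ≟ r 1) (sym r[1]≡s̄₀)))
        (f≤Σf (λ j → if-bool (0ℚ ≤_) (inM 1 j) (λ _ → QP.<⇒≤ (QP.positive⁻¹ 1ℚ)) (λ _ → QP.≤-refl)) zero)
      1/|M₁|≤1 : 1ℚ ÷₀ count (inM 1) ≤ 1ℚ
      1/|M₁|≤1 = ÷₀-≤ 1ℚ (QP.<-≤-trans (QP.positive⁻¹ 1ℚ) 1≤|M₁|)
        (subst (1ℚ ≤_) (sym (QP.*-identityˡ _)) 1≤|M₁|)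
      share≤ : s̄ i ≡ r 1 → (1ℚ ÷₀ count (inM 1)) * p₁ ≤ two * T * s i
      share≤ s̄≡r₁ = begin
        (1ℚ ÷₀ count (inM 1)) * p₁  ≤⟨ *-monoʳ-≤ p₁ (QP.<⇒≤ p₁>0) 1/|M₁|≤1 ⟩
        1ℚ * p₁                     ≡⟨ QP.*-identityˡ p₁ ⟩
        p₁                          ≤⟨ p₁≤s₀T ⟩
        s zero * T                  ≤⟨ *-monoʳ-≤ T T≥0 (QP.<⇒≤ (s<two*s̄ zero)) ⟩
        two * s̄ zero * T            ≡⟨ cong (λ z → two * z * T) (trans (sym r[1]≡s̄₀) (sym s̄≡r₁)) ⟩
        two * s̄ i * T               ≤⟨ *-monoʳ-≤ T T≥0 (*-monoˡ-≤ two two-nonNeg (s̄≤s i)) ⟩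
        two * s i * T               ≡⟨ solve 3 (λ a b c → a :* b :* c := a :* c :* b) refl two (s i) T ⟩
        two * T * s i               ∎
        where open QP.≤-Reasoning

lemma9 : Σ[ c ∈ ℕ ]
    ((m' : ℕ) (s : Fin (suc m') → ℚ) (e : Fin (suc m') → ℤ) →
     (∀ i → 0ℚ < s i) →
     (∀ i j → i Fin.≤ j → s j ≤ s i) →
     (∀ i → (pow2 (e i) ≤ s i) × (s i < pow2 (e i ℤ.+ ℤ.+ 1))) →
     (p₁ : ℚ) (ps : List ℚ) → 0ℚ < p₁ → All (0ℚ <_) ps →
     (σ : Fin (length (p₁ ∷ ps)) → Fin (suc m')) →
     obj s (LBPA.allocate e p₁ ps) (p₁ ∷ ps)
       ≤ ((ℤ.+ (c ℕ.* (⌊log₂ suc m' ⌋ ℕ.+ 1))) / 1) * makespan s (p₁ ∷ ps) σ)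
lemma9 = 32 , λ m' s e _ s-antitone s-bracket p₁ ps p₁>0 ps>0 σ →
  Analysis.obj≤32K*makespan s e s-antitone s-bracket p₁>0 ps>0 σ
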